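{- Let $p$ be a prime, $n,m\in\mathbb{N}$, $0\le i\le n$ and $t\in\mathbb{N}\cup\{0\}$. Let $(b_j)_{j=0}^t$ be a decreasing sequence of elements of $\{0,\dots,m-1\}$ and $(c_j)_{j=0}^t$ an increasing sequence of elements of $\{ -\infty,0,\dots,i-1\}$. If $c_0=-\infty$, then $\mathrm{ann}_{R_mG_i}\langle p^{b_0},\{p^{b_j}(\sigma^{p^{c_j}}-1)\}_{j=1}^t\rangle$ equals $\langle p^{m-b_0}\rangle$ if $t=0$, and equals $\langle p^{m-b_0}P(i,c_1),\dots,p^{m-b_{t-1}}P(i,c_t),p^{m-b_t}\rangle$ if $t>0$. If $c_0\neq-\infty$, then $\mathrm{ann}_{R_mG_i}\langle\{p^{b_j}(\sigma^{p^{c_j}}-1)\}_{j=0}^t\rangle$ equals $\langle P(i,c_0),p^{m-b_0}\rangle$ if $t=0$, and equals $\langle P(i,c_0),p^{m-b_0}P(i,c_1),\dots,p^{m-b_{t-1}}P(i,c_t),p^{m-b_t}\rangle$ if $t>0$.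
   Context: $G$ is cyclic of order $p^n$ with generator $\sigma$; $G_i$ its quotient of order $p^i$ (image of $\sigma$ still $\sigma$). $R_m=\mathbb{Z}/p^m\mathbb{Z}$, $R_mG_i$ the group ring; $\langle\cdot\rangle$ is the ideal generated. $P(i,j)=\sum_{k=0}^{p^{i-j}-1}\sigma^{kp^j}$, with the conventions $p^{ -\infty}=0$, $\sigma^{p^{ -\infty}}=0$ and $P(i,-\infty)=1$. -}

module Defs where

open import Data.Nat as ℕ using (ℕ; zero; suc; _^_; _∸_; NonZero; _%_; _≡ᵇ_)
open import Data.Nat.Properties using (m^n≢0)
open import Data.Integer as ℤ using (ℤ; +_; 0ℤ; 1ℤ)
open import Data.Integer.Divisibility using (_∣_)
open import Data.Fin as Fin using (Fin; toℕ)
open import Data.List as List using (List; length; lookup)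
open import Data.Product using (Σ; _×_)
open import Data.Bool using (if_then_else_)
open import Data.Unit using (⊤)

-- Exponents in {-∞} ∪ ℕ  (used for c_j, with p^{-∞} = 0)
data Exp : Set where
  -∞  : Exp
  fin : ℕ → Exp

data _<ᵉ_ : Exp → Exp → Set where
  -∞<fin  : ∀ {k} → -∞ <ᵉ fin k
  fin<fin : ∀ {a b} → a ℕ.< b → fin a <ᵉ fin b

ValidExp : ℕ → Exp → Set
ValidExp i -∞      = ⊤
ValidExp i (fin k) = k ℕ.< i

-- The group ring R_m G_i = (ℤ/p^m)[G_i], G_i cyclic of order p^i generated by σ.
-- An element is represented by its coefficient vector (coefficient of σ^k, k < p^i)
-- with integer entries; equality is coefficientwise congruence mod p^m.
module GroupRing (p : ℕ) (nz : NonZero p) (i m : ℕ) where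

  N : ℕ
  N = p ^ i

  M : ℕ
  M = p ^ m

  instance
    nzN : NonZero N
    nzN = m^n≢0 p i {{nz}}

  Elem : Set
  Elem = Fin N → ℤ

  infix  4 _≈_
  infixl 6 _+ᴱ_ _-ᴱ_
  infixl 7 _*ᴱ_

  _≈_ : Elem → Elem → Set
  a ≈ b = ∀ k → (+ M) ∣ (a k ℤ.- b k)

  0ᴱ : Elem
  0ᴱ _ = 0ℤ

  _+ᴱ_ : Elem → Elem → Elem
  (a +ᴱ b) k = a k ℤ.+ b k

  _-ᴱ_ : Elem → Elem → Elem
  (a -ᴱ b) k = a k ℤ.- b k

  ΣZ : (n : ℕ) → (Fin n → ℤ) → ℤ
  ΣZ zero    f = 0ℤ
  ΣZ (suc n) f = f Fin.zero ℤ.+ ΣZ n (λ k → f (Fin.suc k))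

  ΣE : (n : ℕ) → (Fin n → Elem) → Elem
  ΣE zero    f = 0ᴱ
  ΣE (suc n) f = f Fin.zero +ᴱ ΣE n (λ k → f (Fin.suc k))

  σ^ : ℕ → Elem
  σ^ e k = if toℕ k ≡ᵇ (e % N) then 1ℤ else 0ℤ

  1ᴱ : Elem
  1ᴱ = σ^ 0

  const : ℤ → Elem
  const c k = c ℤ.* 1ᴱ k

  _*ᴱ_ : Elem → Elem → Elem
  (a *ᴱ b) k = ΣZ N (λ j → ΣZ N (λ l →
                 if ((toℕ j ℕ.+ toℕ l) % N) ≡ᵇ toℕ k then a j ℤ.* b l else 0ℤ))

  pw : ℕ → Elem
  pw e = const (+ (p ^ e))

  σ^p^ : Exp → Elem
  σ^p^ -∞      = 0ᴱ
  σ^p^ (fin c) = σ^ (p ^ c)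

  P : Exp → Elem
  P -∞      = 1ᴱ
  P (fin j) = ΣE (p ^ (i ∸ j)) (λ k → σ^ (toℕ k ℕ.* p ^ j))

  _∈⟨_⟩ : Elem → List Elem → Set
  x ∈⟨ gs ⟩ = Σ (Fin (length gs) → Elem) λ r →
                x ≈ ΣE (length gs) (λ k → r k *ᴱ lookup gs k)

  _∈ann⟨_⟩ : Elem → List Elem → Set
  x ∈ann⟨ gs ⟩ = ∀ y → y ∈⟨ gs ⟩ → x *ᴱ y ≈ 0ᴱ

  AnnEq : List Elem → List Elem → Set
  AnnEq gs hs = ∀ x → (x ∈ann⟨ gs ⟩ → x ∈⟨ hs ⟩) × (x ∈⟨ hs ⟩ → x ∈ann⟨ gs ⟩)

-- Everything reduces to one fact about the group ring R = ℤ/p^m [G_i]: if p^K divides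
-- y (σ^(p^c) − 1) coefficientwise, the coefficients of y are p^c-periodic modulo p^K, so
-- y = P(i,c) z + p^K w with z the first p^c coefficients of y.  Peeling the generators off:
-- x p^(b₀) = 0 forces x = p^(m−b₀) y; then x p^(b₁)(σ^(p^(c₁)) − 1) = 0 gives
-- y = P(i,c₁) z + p^(b₀−b₁) w, i.e. x = z · p^(m−b₀) P(i,c₁) + p^(m−b₁) w, and the remainder
-- p^(m−b₁) w again satisfies the hypotheses for the shorter sequences (P(i,c₁) kills
-- σ^(p^c) − 1 for c ≥ c₁), so induction on t finishes.  Conversely, p^(m−bⱼ) p^(bₖ) = 0 for
-- k ≤ j, and P(i,c_(j+1)) kills the generators with k > j.

module Submission where

open import Algebra.Bundles using (CommutativeRing)
open import Algebra.Structures using (IsAbelianGroup)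
open import Data.Bool using (true; false; if_then_else_; T)
open import Data.Empty using (⊥-elim)
open import Data.Fin as Fin using (Fin; inject₁; fromℕ)
import Data.Fin.Properties as Finₚ
open import Data.Integer as ℤ using (ℤ; 0ℤ; 1ℤ)
open import Data.Integer.Divisibility.Signed as ℤ∣ using (_∣_; divides)
import Data.Integer.Properties as ℤₚ
open import Data.Integer.Tactic.RingSolver using (solve-∀)
open import Data.List using (List; _∷_; []; _++_; tabulate; length; lookup)
open import Data.List.Relation.Unary.All as All using (All; _∷_; [])
import Data.List.Relation.Unary.All.Properties as Allₚ
import Data.Nat as ℕ
open import Data.Nat using (ℕ; zero; suc; z≤n; s≤s; _≤_; _<_; _∸_; _^_; NonZero; _%_; _/_)
open import Data.Nat.DivMod
open import Data.Nat.Primality using (Prime; prime⇒nonZero)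
import Data.Nat.Properties as ℕₚ
open import Data.Nat.Tactic.RingSolver using () renaming (solve-∀ to ℕ-solve-∀)
open import Data.Product using (_×_; _,_; Σ; proj₁; proj₂)
open import Data.Unit using (tt)
import Data.Vec.Functional as Vec
open import Function using (_∘_; _⟨_⟩_)
open import Level using (0ℓ; _⊔_)
open import Relation.Binary.PropositionalEquality using (_≡_; _≢_)
import Relation.Binary.Reasoning.Setoid as SetoidReasoning
open import Relation.Nullary using (yes; no)

open import Defs

-- Ideals and annihilators in a commutative ring

module Ideal {c ℓ} (R : CommutativeRing c ℓ) where

  open CommutativeRing R
  open SetoidReasoning setoid

  infix 4 _∈Ideal_
  data _∈Ideal_ : Carrier → List Carrier → Set (c ⊔ ℓ) where
    ∈[] : ∀ {x} → x ≈ 0# → x ∈Ideal []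
    ∈∷  : ∀ {x g gs} r x′ → x ≈ r * g + x′ → x′ ∈Ideal gs → x ∈Ideal g ∷ gs

  Annihilates : Carrier → List Carrier → Set (c ⊔ ℓ)
  Annihilates x = All (λ g → x * g ≈ 0#)

  0∈Ideal : ∀ gs → 0# ∈Ideal gs
  0∈Ideal []       = ∈[] refl
  0∈Ideal (g ∷ gs) = ∈∷ 0# 0# (sym (trans (+-identityʳ _) (zeroˡ g))) (0∈Ideal gs)

  ∈Ideal-there : ∀ {x} g {gs} → x ∈Ideal gs → x ∈Ideal g ∷ gs
  ∈Ideal-there {x} g x∈gs = ∈∷ 0# x (sym (trans (+-congʳ (zeroˡ g)) (+-identityˡ x))) x∈gs

  ∈Ideal-here : ∀ g gs → g ∈Ideal g ∷ gs
  ∈Ideal-here g gs = ∈∷ 1# 0# (sym (trans (+-identityʳ _) (*-identityˡ g))) (0∈Ideal gs)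

  annihilates-∈Ideal : ∀ {x y gs} → Annihilates x gs → y ∈Ideal gs → x * y ≈ 0#
  annihilates-∈Ideal {x} [] (∈[] y≈0) = trans (*-congˡ y≈0) (zeroʳ x)
  annihilates-∈Ideal {x} {y} (xg≈0 ∷ x-ann) (∈∷ {g = g} r y′ y≈rg+y′ y′∈gs) = begin
    x * y                 ≈⟨ *-congˡ y≈rg+y′ ⟩
    x * (r * g + y′)      ≈⟨ distribˡ x (r * g) y′ ⟩
    x * (r * g) + x * y′  ≈⟨ +-congʳ (x*[r*g]≈r*[x*g]) ⟩
    r * (x * g) + x * y′  ≈⟨ +-cong (trans (*-congˡ xg≈0) (zeroʳ r)) (annihilates-∈Ideal x-ann y′∈gs) ⟩
    0# + 0#               ≈⟨ +-identityˡ 0# ⟩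
    0#                    ∎
    where
    x*[r*g]≈r*[x*g] : x * (r * g) ≈ r * (x * g)
    x*[r*g]≈r*[x*g] = trans (sym (*-assoc x r g)) (trans (*-congʳ (*-comm x r)) (*-assoc r x g))

  annihilates-generators : ∀ {x} gs → (∀ {y} → y ∈Ideal gs → x * y ≈ 0#) → Annihilates x gs
  annihilates-generators []       ann = []
  annihilates-generators (g ∷ gs) ann = ann (∈Ideal-here g gs) ∷ annihilates-generators gs (ann ∘ ∈Ideal-there g)

  annihilators-annihilate : ∀ {hs gs x y} → All (λ h → Annihilates h gs) hs →
                            x ∈Ideal hs → y ∈Ideal gs → x * y ≈ 0#
  annihilators-annihilate {hs} {x = x} {y} hs-ann x∈hs y∈gs =
    trans (*-comm x y) (annihilates-∈Ideal y-ann x∈hs)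
    where
    y-ann : Annihilates y hs
    y-ann = All.map (λ {h} h-ann → trans (*-comm y h) (annihilates-∈Ideal h-ann y∈gs)) hs-ann

  annihilates-resp-≈ : ∀ {x y gs} → x ≈ y → Annihilates x gs → Annihilates y gs
  annihilates-resp-≈ x≈y = All.map (trans (*-congʳ (sym x≈y)))

  annihilates-remainder : ∀ {x h x′ gs} z → x ≈ z * h + x′ →
                          Annihilates x gs → Annihilates h gs → Annihilates x′ gs
  annihilates-remainder {x} {h} {x′} z x≈zh+x′ x-ann h-ann = All.zipWith (λ { {g} (xg≈0 , hg≈0) → begin
    x′ * g                    ≈⟨ +-identityˡ (x′ * g) ⟨
    0# + x′ * g               ≈⟨ +-congʳ (trans (*-congˡ hg≈0) (zeroʳ z)) ⟨
    z * (h * g) + x′ * g      ≈⟨ +-congʳ (*-assoc z h g) ⟨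
    z * h * g + x′ * g        ≈⟨ distribʳ g (z * h) x′ ⟨
    (z * h + x′) * g          ≈⟨ *-congʳ x≈zh+x′ ⟨
    x * g                     ≈⟨ xg≈0 ⟩
    0#                        ∎ }) (x-ann , h-ann)

open import Data.Integer using (_+_; _*_; _-_; -_)
open import Relation.Binary.PropositionalEquality
  using (refl; sym; trans; cong; cong₂; subst; subst₂; _≗_; module ≡-Reasoning)

-- Finite sums of integers

∑ : ℕ → (ℕ → ℤ) → ℤ
∑ zero    f = 0ℤ
∑ (suc n) f = f 0 + ∑ n (f ∘ suc)

∑-cong-< : ∀ n {f g : ℕ → ℤ} → (∀ q → q < n → f q ≡ g q) → ∑ n f ≡ ∑ n g
∑-cong-< zero    f≡g = refl
∑-cong-< (suc n) f≡g = cong₂ _+_ (f≡g 0 (s≤s z≤n)) (∑-cong-< n (λ q q<n → f≡g (suc q) (s≤s q<n)))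

∑-cong : ∀ n {f g : ℕ → ℤ} → (∀ q → f q ≡ g q) → ∑ n f ≡ ∑ n g
∑-cong n f≡g = ∑-cong-< n (λ q _ → f≡g q)

∑-zero : ∀ n → ∑ n (λ _ → 0ℤ) ≡ 0ℤ
∑-zero zero    = refl
∑-zero (suc n) = trans (ℤₚ.+-identityˡ _) (∑-zero n)

∑-vanish : ∀ n {f : ℕ → ℤ} → (∀ q → q < n → f q ≡ 0ℤ) → ∑ n f ≡ 0ℤ
∑-vanish n f≡0 = trans (∑-cong-< n f≡0) (∑-zero n)

∑-+ : ∀ n (f g : ℕ → ℤ) → ∑ n (λ q → f q + g q) ≡ ∑ n f + ∑ n g
∑-+ zero    f g = refl
∑-+ (suc n) f g = trans (cong (f 0 + g 0 +_) (∑-+ n (f ∘ suc) (g ∘ suc)))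
                        (interchange (f 0) (g 0) _ _)
  where
  interchange : ∀ a b c d → a + b + (c + d) ≡ a + c + (b + d)
  interchange = solve-∀

∑-*ˡ : ∀ n c (f : ℕ → ℤ) → c * ∑ n f ≡ ∑ n (λ q → c * f q)
∑-*ˡ zero    c f = ℤₚ.*-zeroʳ c
∑-*ˡ (suc n) c f = trans (ℤₚ.*-distribˡ-+ c (f 0) _) (cong (c * f 0 +_) (∑-*ˡ n c (f ∘ suc)))

∑-*ʳ : ∀ n c (f : ℕ → ℤ) → ∑ n f * c ≡ ∑ n (λ q → f q * c)
∑-*ʳ n c f = trans (ℤₚ.*-comm (∑ n f) c)
                   (trans (∑-*ˡ n c f) (∑-cong n (λ q → ℤₚ.*-comm c (f q))))

∑-swap : ∀ n k (f : ℕ → ℕ → ℤ) → ∑ n (λ j → ∑ k (f j)) ≡ ∑ k (λ l → ∑ n (λ j → f j l))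
∑-swap zero    k f = sym (∑-zero k)
∑-swap (suc n) k f = trans (cong (∑ k (f 0) +_) (∑-swap n k (f ∘ suc)))
                           (sym (∑-+ k (f 0) _))

∑-reorder₄ : ∀ n (F : ℕ → ℕ → ℕ → ℕ → ℤ) →
  ∑ n (λ u → ∑ n λ l → ∑ n λ j → ∑ n λ j′ → F u l j j′) ≡
  ∑ n (λ j → ∑ n λ j′ → ∑ n λ l → ∑ n λ u → F u l j j′)
∑-reorder₄ n F = begin
  ∑ n (λ u → ∑ n λ l → ∑ n λ j → ∑ n λ j′ → F u l j j′)  ≡⟨ ∑-cong n (λ u → ∑-swap n n _) ⟩
  ∑ n (λ u → ∑ n λ j → ∑ n λ l → ∑ n λ j′ → F u l j j′)  ≡⟨ ∑-cong n (λ u → ∑-cong n λ j → ∑-swap n n _) ⟩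
  ∑ n (λ u → ∑ n λ j → ∑ n λ j′ → ∑ n λ l → F u l j j′)  ≡⟨ ∑-swap n n _ ⟩
  ∑ n (λ j → ∑ n λ u → ∑ n λ j′ → ∑ n λ l → F u l j j′)  ≡⟨ ∑-cong n (λ j → ∑-swap n n _) ⟩
  ∑ n (λ j → ∑ n λ j′ → ∑ n λ u → ∑ n λ l → F u l j j′)  ≡⟨ ∑-cong n (λ j → ∑-cong n λ j′ → ∑-swap n n _) ⟩
  ∑ n (λ j → ∑ n λ j′ → ∑ n λ l → ∑ n λ u → F u l j j′)  ∎
  where open ≡-Reasoning

∑-++ : ∀ a b (f : ℕ → ℤ) → ∑ (a ℕ.+ b) f ≡ ∑ a f + ∑ b (λ q → f (a ℕ.+ q))
∑-++ zero    b f = sym (ℤₚ.+-identityˡ _)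
∑-++ (suc a) b f = trans (cong (f 0 +_) (∑-++ a b (f ∘ suc))) (sym (ℤₚ.+-assoc (f 0) _ _))

∑-truncate : ∀ {n e} (f : ℕ → ℤ) → e ≤ n → (∀ q → e ≤ q → q < n → f q ≡ 0ℤ) → ∑ n f ≡ ∑ e f
∑-truncate {n} {e} f e≤n f≡0 = begin
  ∑ n f                                      ≡⟨ cong (λ k → ∑ k f) (sym (ℕₚ.m+[n∸m]≡n e≤n)) ⟩
  ∑ (e ℕ.+ (n ∸ e)) f                        ≡⟨ ∑-++ e (n ∸ e) f ⟩
  ∑ e f + ∑ (n ∸ e) (λ q → f (e ℕ.+ q))      ≡⟨ cong (∑ e f +_) (∑-vanish (n ∸ e) tail≡0) ⟩
  ∑ e f + 0ℤ                                 ≡⟨ ℤₚ.+-identityʳ _ ⟩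
  ∑ e f                                      ∎
  where
  open ≡-Reasoning
  tail≡0 : ∀ q → q < n ∸ e → f (e ℕ.+ q) ≡ 0ℤ
  tail≡0 q q<n∸e = f≡0 (e ℕ.+ q) (ℕₚ.m≤m+n e q)
                        (subst (e ℕ.+ q <_) (ℕₚ.m+[n∸m]≡n e≤n) (ℕₚ.+-monoʳ-< e q<n∸e))

∑-blocks : ∀ a e (f : ℕ → ℤ) → ∑ (a ℕ.* e) f ≡ ∑ a (λ s → ∑ e (λ l → f (s ℕ.* e ℕ.+ l)))
∑-blocks zero    e f = refl
∑-blocks (suc a) e f = trans (∑-++ e (a ℕ.* e) f) (cong (∑ e f +_) (trans
  (∑-blocks a e (λ q → f (e ℕ.+ q)))
  (∑-cong a (λ s → ∑-cong e (λ l → cong f (sym (ℕₚ.+-assoc e (s ℕ.* e) l)))))))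

∑-single : ∀ n (f : ℕ → ℤ) {q₀} → q₀ < n → (∀ q → q < n → q ≢ q₀ → f q ≡ 0ℤ) → ∑ n f ≡ f q₀
∑-single (suc n) f {zero} _ f≡0 =
  trans (cong (f 0 +_) (∑-vanish n (λ q q<n → f≡0 (suc q) (s≤s q<n) λ ())))
        (ℤₚ.+-identityʳ _)
∑-single (suc n) f {suc q₀} (s≤s q₀<n) f≡0 =
  trans (cong (_+ ∑ n (f ∘ suc)) (f≡0 0 (s≤s z≤n) λ ()))
        (trans (ℤₚ.+-identityˡ _)
               (∑-single n (f ∘ suc) q₀<n (λ q q<n q≢q₀ → f≡0 (suc q) (s≤s q<n) (q≢q₀ ∘ ℕₚ.suc-injective))))

∑-last : ∀ n (f : ℕ → ℤ) → ∑ (suc n) f ≡ ∑ n f + f n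
∑-last n f = begin
  ∑ (suc n) f                 ≡⟨ cong (λ k → ∑ k f) (ℕₚ.+-comm 1 n) ⟩
  ∑ (n ℕ.+ 1) f               ≡⟨ ∑-++ n 1 f ⟩
  ∑ n f + (f (n ℕ.+ 0) + 0ℤ)  ≡⟨ cong (∑ n f +_) (trans (ℤₚ.+-identityʳ _) (cong f (ℕₚ.+-identityʳ n))) ⟩
  ∑ n f + f n                 ∎
  where open ≡-Reasoning

∑-rotate₁ : ∀ n (f : ℕ → ℤ) → f n ≡ f 0 → ∑ n (f ∘ suc) ≡ ∑ n f
∑-rotate₁ n f fn≡f0 = begin
  ∑ n (f ∘ suc)              ≡⟨ add-sub (∑ n (f ∘ suc)) (f 0) ⟩
  f 0 + ∑ n (f ∘ suc) - f 0  ≡⟨ cong (_- f 0) (∑-last n f) ⟩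
  ∑ n f + f n - f 0          ≡⟨ cong (λ x → ∑ n f + x - f 0) fn≡f0 ⟩
  ∑ n f + f 0 - f 0          ≡⟨ sym (add-sub' (∑ n f) (f 0)) ⟩
  ∑ n f                      ∎
  where
  open ≡-Reasoning
  add-sub : ∀ a b → a ≡ b + a - b
  add-sub = solve-∀
  add-sub' : ∀ a b → a ≡ a + b - b
  add-sub' = solve-∀

∑-rotate : ∀ n (f : ℕ → ℤ) → (∀ s → f (s ℕ.+ n) ≡ f s) → ∀ u → ∑ n (λ s → f (s ℕ.+ u)) ≡ ∑ n f
∑-rotate n f periodic zero    = ∑-cong n (λ s → cong f (ℕₚ.+-identityʳ s))
∑-rotate n f periodic (suc u) = begin
  ∑ n (λ s → f (s ℕ.+ suc u))  ≡⟨ ∑-cong n (λ s → cong f (ℕₚ.+-suc s u)) ⟩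
  ∑ n (λ s → f (suc s ℕ.+ u))  ≡⟨ ∑-rotate₁ n (λ s → f (s ℕ.+ u)) (cong f (ℕₚ.+-comm n u) ⟨ trans ⟩ periodic u) ⟩
  ∑ n (λ s → f (s ℕ.+ u))      ≡⟨ ∑-rotate n f periodic u ⟩
  ∑ n f                         ∎
  where open ≡-Reasoning

δ : ℕ → ℕ → ℤ
δ x y = if x ℕ.≡ᵇ y then 1ℤ else 0ℤ

if-as-δ : ∀ x y u → (if x ℕ.≡ᵇ y then u else 0ℤ) ≡ δ x y * u
if-as-δ x y u with x ℕ.≡ᵇ y
... | true  = sym (ℤₚ.*-identityˡ u)
... | false = refl

δ-≡ : ∀ {x y} → x ≡ y → δ x y ≡ 1ℤ
δ-≡ {x} {y} x≡y with x ℕ.≡ᵇ y in eq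
... | true  = refl
... | false = ⊥-elim (subst T eq (ℕₚ.≡⇒≡ᵇ x y x≡y))

δ-≢ : ∀ {x y} → x ≢ y → δ x y ≡ 0ℤ
δ-≢ {x} {y} x≢y with x ℕ.≡ᵇ y in eq
... | true  = ⊥-elim (x≢y (ℕₚ.≡ᵇ⇒≡ x y (subst T (sym eq) tt)))
... | false = refl

δ-sym : ∀ x y → δ x y ≡ δ y x
δ-sym x y with x ℕₚ.≟ y
... | yes x≡y = trans (δ-≡ x≡y) (sym (δ-≡ (sym x≡y)))
... | no  x≢y = trans (δ-≢ x≢y) (sym (δ-≢ (x≢y ∘ sym)))

δ-*-zero : ∀ {x y} → x ≢ y → ∀ u → δ x y * u ≡ 0ℤ
δ-*-zero x≢y u = trans (cong (_* u) (δ-≢ x≢y)) (ℤₚ.*-zeroˡ u)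

δ-*-one : ∀ {x y} → x ≡ y → ∀ u → δ x y * u ≡ u
δ-*-one x≡y u = trans (cong (_* u) (δ-≡ x≡y)) (ℤₚ.*-identityˡ u)

∑-δ : ∀ n (f : ℕ → ℤ) {q₀} → q₀ < n → ∑ n (λ q → δ q₀ q * f q) ≡ f q₀
∑-δ n f {q₀} q₀<n = trans (∑-single n _ q₀<n (λ q _ q≢q₀ → δ-*-zero (q≢q₀ ∘ sym) (f q)))
                          (δ-*-one {q₀} refl (f q₀))

-- Congruences of integers

infix 4 _≡_[mod_]
record _≡_[mod_] (a b d : ℤ) : Set where
  constructor ≡-mod
  field
    divides-difference : d ∣ a - b

open _≡_[mod_]

≡⇒≡-mod : ∀ {d a b} → a ≡ b → a ≡ b [mod d ]
≡⇒≡-mod {a = a} refl = ≡-mod (divides 0ℤ (ℤₚ.+-inverseʳ a))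

≡-mod-sym : ∀ {d a b} → a ≡ b [mod d ] → b ≡ a [mod d ]
≡-mod-sym {d} {a} {b} (≡-mod d∣a-b) = ≡-mod (subst (d ∣_) (negate-sub a b) (ℤ∣.∣m⇒∣-m d∣a-b))
  where
  negate-sub : ∀ a b → - (a - b) ≡ b - a
  negate-sub = solve-∀

≡-mod-trans : ∀ {d a b c} → a ≡ b [mod d ] → b ≡ c [mod d ] → a ≡ c [mod d ]
≡-mod-trans {d} {a} {b} {c} (≡-mod d∣a-b) (≡-mod d∣b-c) =
  ≡-mod (subst (d ∣_) (telescope a b c) (ℤ∣.∣m∣n⇒∣m+n d∣a-b d∣b-c))
  where
  telescope : ∀ a b c → (a - b) + (b - c) ≡ a - c
  telescope = solve-∀

≡-mod-+ : ∀ {d a a′ b b′} → a ≡ a′ [mod d ] → b ≡ b′ [mod d ] → a + b ≡ a′ + b′ [mod d ]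
≡-mod-+ {d} {a} {a′} {b} {b′} (≡-mod d∣a-a′) (≡-mod d∣b-b′) =
  ≡-mod (subst (d ∣_) (regroup a a′ b b′) (ℤ∣.∣m∣n⇒∣m+n d∣a-a′ d∣b-b′))
  where
  regroup : ∀ a a′ b b′ → (a - a′) + (b - b′) ≡ (a + b) - (a′ + b′)
  regroup = solve-∀

≡-mod-neg : ∀ {d a a′} → a ≡ a′ [mod d ] → - a ≡ - a′ [mod d ]
≡-mod-neg {d} {a} {a′} (≡-mod d∣a-a′) = ≡-mod (subst (d ∣_) (negate-sub a a′) (ℤ∣.∣m⇒∣-m d∣a-a′))
  where
  negate-sub : ∀ a b → - (a - b) ≡ - a - - b
  negate-sub = solve-∀

≡-mod-quotient : ∀ {d a b} → a ≡ b [mod d ] → ℤ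
≡-mod-quotient a≡b = _∣_.quotient (divides-difference a≡b)

≡-mod⇒≡+* : ∀ {d a b} (a≡b : a ≡ b [mod d ]) → a ≡ b + d * ≡-mod-quotient a≡b
≡-mod⇒≡+* {d} {a} {b} a≡b = begin
  a                                   ≡⟨ add-sub a b ⟩
  b + (a - b)                         ≡⟨ cong (b +_) (_∣_.equality (divides-difference a≡b)) ⟩
  b + ≡-mod-quotient a≡b * d          ≡⟨ cong (b +_) (ℤₚ.*-comm (≡-mod-quotient a≡b) d) ⟩
  b + d * ≡-mod-quotient a≡b          ∎
  where
  open ≡-Reasoning
  add-sub : ∀ a b → a ≡ b + (a - b)
  add-sub = solve-∀

[m%d+n]%d≡[m+n]%d : ∀ m n d .{{_ : NonZero d}} → (m % d ℕ.+ n) % d ≡ (m ℕ.+ n) % d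
[m%d+n]%d≡[m+n]%d m n d = begin
  (m % d ℕ.+ n) % d            ≡⟨ %-distribˡ-+ (m % d) n d ⟩
  (m % d % d ℕ.+ n % d) % d    ≡⟨ cong (λ x → (x ℕ.+ n % d) % d) (m%n%n≡m%n m d) ⟩
  (m % d ℕ.+ n % d) % d        ≡⟨ %-distribˡ-+ m n d ⟨
  (m ℕ.+ n) % d                ∎
  where open ≡-Reasoning

[m+n%d]%d≡[m+n]%d : ∀ m n d .{{_ : NonZero d}} → (m ℕ.+ n % d) % d ≡ (m ℕ.+ n) % d
[m+n%d]%d≡[m+n]%d m n d = begin
  (m ℕ.+ n % d) % d  ≡⟨ cong (_% d) (ℕₚ.+-comm m (n % d)) ⟩
  (n % d ℕ.+ m) % d  ≡⟨ [m%d+n]%d≡[m+n]%d n m d ⟩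
  (n ℕ.+ m) % d      ≡⟨ cong (_% d) (ℕₚ.+-comm n m) ⟩
  (m ℕ.+ n) % d      ∎
  where open ≡-Reasoning

periodic-≡-mod : ∀ {d} e .{{_ : NonZero e}} (f : ℕ → ℤ) →
                 (∀ q → f (e ℕ.+ q) ≡ f q [mod d ]) → ∀ q → f q ≡ f (q % e) [mod d ]
periodic-≡-mod {d} e f period q = subst (λ x → f x ≡ f (q % e) [mod d ]) (sym q≡) (blocks (q / e) (q % e))
  where
  blocks : ∀ a r → f (a ℕ.* e ℕ.+ r) ≡ f r [mod d ]
  blocks zero    r = ≡⇒≡-mod refl
  blocks (suc a) r = ≡-mod-trans (subst (λ x → f x ≡ f (a ℕ.* e ℕ.+ r) [mod d ])
                                        (sym (ℕₚ.+-assoc e (a ℕ.* e) r)) (period (a ℕ.* e ℕ.+ r)))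
                                 (blocks a r)
  q≡ : q ≡ q / e ℕ.* e ℕ.+ q % e
  q≡ = trans (m≡m%n+[m/n]*n q e) (ℕₚ.+-comm (q % e) _)

[d∸m%d+[m+n]]%d≡n : ∀ m n d .{{_ : NonZero d}} → n < d → (d ∸ m % d ℕ.+ (m ℕ.+ n)) % d ≡ n
[d∸m%d+[m+n]]%d≡n m n d n<d = begin
  (d ∸ r ℕ.+ (m ℕ.+ n)) % d              ≡⟨ cong (λ x → (d ∸ r ℕ.+ (x ℕ.+ n)) % d) (m≡m%n+[m/n]*n m d) ⟩
  (d ∸ r ℕ.+ (r ℕ.+ q ℕ.* d ℕ.+ n)) % d  ≡⟨ cong (_% d) (regroup (d ∸ r) r q n d) ⟩
  (n ℕ.+ (d ∸ r ℕ.+ r) ℕ.+ q ℕ.* d) % d  ≡⟨ cong (λ x → (n ℕ.+ x ℕ.+ q ℕ.* d) % d) d∸r+r≡d ⟩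
  (n ℕ.+ d ℕ.+ q ℕ.* d) % d              ≡⟨ [m+kn]%n≡m%n (n ℕ.+ d) q d ⟩
  (n ℕ.+ d) % d                          ≡⟨ [m+n]%n≡m%n n d ⟩
  n % d                                  ≡⟨ m<n⇒m%n≡m n<d ⟩
  n                                      ∎
  where
  open ≡-Reasoning
  r = m % d
  q = m / d
  d∸r+r≡d : d ∸ r ℕ.+ r ≡ d
  d∸r+r≡d = ℕₚ.m∸n+n≡m (ℕₚ.<⇒≤ (m%n<n m d))
  regroup : ∀ s r q n d → s ℕ.+ (r ℕ.+ q ℕ.* d ℕ.+ n) ≡ n ℕ.+ (s ℕ.+ r) ℕ.+ q ℕ.* d
  regroup = ℕ-solve-∀

[m+n]%d-injective : ∀ m {n n′} d .{{_ : NonZero d}} → n < d → n′ < d →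
                    (m ℕ.+ n) % d ≡ (m ℕ.+ n′) % d → n ≡ n′
[m+n]%d-injective m {n} {n′} d n<d n′<d eq = begin
  n                                  ≡⟨ [d∸m%d+[m+n]]%d≡n m n d n<d ⟨
  (d ∸ m % d ℕ.+ (m ℕ.+ n)) % d      ≡⟨ [m+n%d]%d≡[m+n]%d (d ∸ m % d) (m ℕ.+ n) d ⟨
  (d ∸ m % d ℕ.+ (m ℕ.+ n) % d) % d  ≡⟨ cong (λ x → (d ∸ m % d ℕ.+ x) % d) eq ⟩
  (d ∸ m % d ℕ.+ (m ℕ.+ n′) % d) % d ≡⟨ [m+n%d]%d≡[m+n]%d (d ∸ m % d) (m ℕ.+ n′) d ⟩
  (d ∸ m % d ℕ.+ (m ℕ.+ n′)) % d     ≡⟨ [d∸m%d+[m+n]]%d≡n m n′ d n′<d ⟩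
  n′                                 ∎
  where open ≡-Reasoning

-- The group ring R_m G_i

module GroupRingProperties (p : ℕ) (nz : NonZero p) (i m : ℕ) where

  open GroupRing p nz i m

  idx : ℕ → Fin N
  idx q = Fin.fromℕ< (m%n<n q N)

  toℕ-idx : ∀ q → Fin.toℕ (idx q) ≡ q % N
  toℕ-idx q = Finₚ.toℕ-fromℕ< (m%n<n q N)

  idx-toℕ : ∀ k → idx (Fin.toℕ k) ≡ k
  idx-toℕ k = Finₚ.toℕ-injective (trans (toℕ-idx (Fin.toℕ k)) (m<n⇒m%n≡m (Finₚ.toℕ<n k)))

  -- The coefficient of σ^q, with q read modulo N.
  coeff : Elem → ℕ → ℤ
  coeff a q = a (idx q)

  coeff-toℕ : ∀ a k → coeff a (Fin.toℕ k) ≡ a k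
  coeff-toℕ a k = cong a (idx-toℕ k)

  coeff-cong : ∀ a {q q′} → q % N ≡ q′ % N → coeff a q ≡ coeff a q′
  coeff-cong a {q} {q′} q≡q′ =
    cong a (Finₚ.toℕ-injective (trans (toℕ-idx q) (trans q≡q′ (sym (toℕ-idx q′)))))

  ΣZ≡∑ : ∀ n (f : Fin n → ℤ) (g : ℕ → ℤ) → (∀ k → f k ≡ g (Fin.toℕ k)) → ΣZ n f ≡ ∑ n g
  ΣZ≡∑ zero    f g f≡g = refl
  ΣZ≡∑ (suc n) f g f≡g = cong₂ _+_ (f≡g Fin.zero) (ΣZ≡∑ n (f ∘ Fin.suc) (g ∘ suc) (f≡g ∘ Fin.suc))

  ΣE-apply : ∀ n (f : Fin n → Elem) k → ΣE n f k ≡ ΣZ n (λ j → f j k)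
  ΣE-apply zero    f k = refl
  ΣE-apply (suc n) f k = cong (f Fin.zero k +_) (ΣE-apply n (f ∘ Fin.suc) k)

  conv : Elem → Elem → ℕ → ℤ
  conv a b q = ∑ N (λ j → ∑ N (λ l → δ ((j ℕ.+ l) % N) q * (coeff a j * coeff b l)))

  *ᴱ≡conv : ∀ a b k → (a *ᴱ b) k ≡ conv a b (Fin.toℕ k)
  *ᴱ≡conv a b k = ΣZ≡∑ N _ _ λ j → ΣZ≡∑ N _ _ λ l →
    trans (if-as-δ ((Fin.toℕ j ℕ.+ Fin.toℕ l) % N) (Fin.toℕ k) (a j * b l))
          (cong (δ ((Fin.toℕ j ℕ.+ Fin.toℕ l) % N) (Fin.toℕ k) *_)
                (sym (cong₂ _*_ (coeff-toℕ a j) (coeff-toℕ b l))))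

  coeff-*ᴱ : ∀ a b {q} → q < N → coeff (a *ᴱ b) q ≡ conv a b q
  coeff-*ᴱ a b {q} q<N = trans (*ᴱ≡conv a b (idx q)) (cong (conv a b) (trans (toℕ-idx q) (m<n⇒m%n≡m q<N)))

  infixr 7 _·ᴱ_
  _·ᴱ_ : ℤ → Elem → Elem
  (s ·ᴱ a) k = s * a k

  *ᴱ-comm : ∀ a b → a *ᴱ b ≗ b *ᴱ a
  *ᴱ-comm a b k = begin
    (a *ᴱ b) k  ≡⟨ *ᴱ≡conv a b k ⟩
    conv a b q  ≡⟨ ∑-swap N N _ ⟩
    ∑ N (λ l → ∑ N (λ j → δ ((j ℕ.+ l) % N) q * (coeff a j * coeff b l)))
                ≡⟨ ∑-cong N (λ l → ∑-cong N (λ j → cong₂ _*_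
                     (cong (λ x → δ (x % N) q) (ℕₚ.+-comm j l)) (ℤₚ.*-comm (coeff a j) (coeff b l)))) ⟩
    conv b a q  ≡⟨ *ᴱ≡conv b a k ⟨
    (b *ᴱ a) k  ∎
    where
    open ≡-Reasoning
    q = Fin.toℕ k

  conv₃ : Elem → Elem → Elem → ℕ → ℤ
  conv₃ a b c q = ∑ N λ j → ∑ N λ j′ → ∑ N λ l →
    δ ((j ℕ.+ j′ ℕ.+ l) % N) q * (coeff a j * coeff b j′ * coeff c l)

  conv₃-rotate : ∀ a b c q → conv₃ a b c q ≡ conv₃ b c a q
  conv₃-rotate a b c q = begin
    conv₃ a b c q
      ≡⟨ ∑-swap N N _ ⟩
    ∑ N (λ j′ → ∑ N λ j → ∑ N λ l → F j j′ l)
      ≡⟨ ∑-cong N (λ j′ → ∑-swap N N _) ⟩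
    ∑ N (λ j′ → ∑ N λ l → ∑ N λ j → F j j′ l)
      ≡⟨ ∑-cong N (λ j′ → ∑-cong N λ l → ∑-cong N λ j → cong₂ _*_
           (cong (λ x → δ (x % N) q) (rotate-+ j j′ l)) (rotate-* (coeff a j) (coeff b j′) (coeff c l))) ⟩
    conv₃ b c a q ∎
    where
    open ≡-Reasoning
    F : ℕ → ℕ → ℕ → ℤ
    F j j′ l = δ ((j ℕ.+ j′ ℕ.+ l) % N) q * (coeff a j * coeff b j′ * coeff c l)
    rotate-+ : ∀ j j′ l → j ℕ.+ j′ ℕ.+ l ≡ j′ ℕ.+ l ℕ.+ j
    rotate-+ = ℕ-solve-∀
    rotate-* : ∀ x y z → x * y * z ≡ y * z * x
    rotate-* = solve-∀

  *ᴱ≡conv₃ : ∀ a b c k → ((a *ᴱ b) *ᴱ c) k ≡ conv₃ a b c (Fin.toℕ k)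
  *ᴱ≡conv₃ a b c k = begin
    ((a *ᴱ b) *ᴱ c) k
      ≡⟨ *ᴱ≡conv (a *ᴱ b) c k ⟩
    ∑ N (λ u → ∑ N λ l → δ ((u ℕ.+ l) % N) q * (coeff (a *ᴱ b) u * coeff c l))
      ≡⟨ ∑-cong-< N (λ u u<N → ∑-cong N λ l →
           cong (λ x → δ ((u ℕ.+ l) % N) q * (x * coeff c l)) (coeff-*ᴱ a b u<N)) ⟩
    ∑ N (λ u → ∑ N λ l → δ ((u ℕ.+ l) % N) q * (conv a b u * coeff c l))
      ≡⟨ ∑-cong N (λ u → ∑-cong N λ l → expand u l) ⟩
    ∑ N (λ u → ∑ N λ l → ∑ N λ j → ∑ N λ j′ → δ ((j ℕ.+ j′) % N) u * G u l j j′)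
      ≡⟨ ∑-reorder₄ N (λ u l j j′ → δ ((j ℕ.+ j′) % N) u * G u l j j′) ⟩
    ∑ N (λ j → ∑ N λ j′ → ∑ N λ l → ∑ N λ u → δ ((j ℕ.+ j′) % N) u * G u l j j′)
      ≡⟨ ∑-cong N (λ j → ∑-cong N λ j′ → ∑-cong N λ l → ∑-δ N (λ u → G u l j j′) (m%n<n (j ℕ.+ j′) N)) ⟩
    ∑ N (λ j → ∑ N λ j′ → ∑ N λ l → G ((j ℕ.+ j′) % N) l j j′)
      ≡⟨ ∑-cong N (λ j → ∑-cong N λ j′ → ∑-cong N λ l →
           cong (λ x → δ x q * (coeff a j * coeff b j′ * coeff c l)) ([m%d+n]%d≡[m+n]%d (j ℕ.+ j′) l N)) ⟩
    conv₃ a b c q ∎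
    where
    open ≡-Reasoning
    q = Fin.toℕ k
    G : ℕ → ℕ → ℕ → ℕ → ℤ
    G u l j j′ = δ ((u ℕ.+ l) % N) q * (coeff a j * coeff b j′ * coeff c l)
    expand : ∀ u l → δ ((u ℕ.+ l) % N) q * (conv a b u * coeff c l) ≡
                     ∑ N (λ j → ∑ N λ j′ → δ ((j ℕ.+ j′) % N) u * G u l j j′)
    expand u l = begin
      d * (conv a b u * z)
        ≡⟨ cong (d *_) (∑-*ʳ N z _ ⟨ trans ⟩ ∑-cong N (λ j → ∑-*ʳ N z _)) ⟩
      d * ∑ N (λ j → ∑ N λ j′ → δ ((j ℕ.+ j′) % N) u * (coeff a j * coeff b j′) * z)
        ≡⟨ ∑-*ˡ N d _ ⟨ trans ⟩ ∑-cong N (λ j → ∑-*ˡ N d _) ⟩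
      ∑ N (λ j → ∑ N λ j′ → d * (δ ((j ℕ.+ j′) % N) u * (coeff a j * coeff b j′) * z))
        ≡⟨ ∑-cong N (λ j → ∑-cong N λ j′ → shuffle d (δ ((j ℕ.+ j′) % N) u) (coeff a j) (coeff b j′) z) ⟩
      ∑ N (λ j → ∑ N λ j′ → δ ((j ℕ.+ j′) % N) u * G u l j j′) ∎
      where
      d = δ ((u ℕ.+ l) % N) q
      z = coeff c l
      shuffle : ∀ d e x y z → d * (e * (x * y) * z) ≡ e * (d * (x * y * z))
      shuffle = solve-∀

  *ᴱ-assoc : ∀ a b c → (a *ᴱ b) *ᴱ c ≗ a *ᴱ (b *ᴱ c)
  *ᴱ-assoc a b c k = begin
    ((a *ᴱ b) *ᴱ c) k          ≡⟨ *ᴱ≡conv₃ a b c k ⟩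
    conv₃ a b c (Fin.toℕ k)    ≡⟨ conv₃-rotate a b c (Fin.toℕ k) ⟩
    conv₃ b c a (Fin.toℕ k)    ≡⟨ *ᴱ≡conv₃ b c a k ⟨
    ((b *ᴱ c) *ᴱ a) k          ≡⟨ *ᴱ-comm (b *ᴱ c) a k ⟩
    (a *ᴱ (b *ᴱ c)) k          ∎
    where open ≡-Reasoning

  *ᴱ-distribˡ-+ᴱ : ∀ a b c → a *ᴱ (b +ᴱ c) ≗ a *ᴱ b +ᴱ a *ᴱ c
  *ᴱ-distribˡ-+ᴱ a b c k = begin
    (a *ᴱ (b +ᴱ c)) k
      ≡⟨ *ᴱ≡conv a (b +ᴱ c) k ⟩
    ∑ N (λ j → ∑ N λ l → δ ((j ℕ.+ l) % N) q * (coeff a j * (coeff b l + coeff c l)))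
      ≡⟨ ∑-cong N (λ j → ∑-cong N λ l → distrib (δ ((j ℕ.+ l) % N) q) (coeff a j) (coeff b l) (coeff c l)) ⟩
    ∑ N (λ j → ∑ N λ l → δ ((j ℕ.+ l) % N) q * (coeff a j * coeff b l)
                          + δ ((j ℕ.+ l) % N) q * (coeff a j * coeff c l))
      ≡⟨ ∑-cong N (λ j → ∑-+ N _ _) ⟨ trans ⟩ ∑-+ N _ _ ⟩
    conv a b q + conv a c q
      ≡⟨ cong₂ _+_ (*ᴱ≡conv a b k) (*ᴱ≡conv a c k) ⟨
    (a *ᴱ b +ᴱ a *ᴱ c) k ∎
    where
    open ≡-Reasoning
    q = Fin.toℕ k
    distrib : ∀ d x y z → d * (x * (y + z)) ≡ d * (x * y) + d * (x * z)
    distrib = solve-∀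

  *ᴱ-distribʳ-+ᴱ : ∀ a b c → (b +ᴱ c) *ᴱ a ≗ b *ᴱ a +ᴱ c *ᴱ a
  *ᴱ-distribʳ-+ᴱ a b c k = trans (*ᴱ-comm (b +ᴱ c) a k)
    (trans (*ᴱ-distribˡ-+ᴱ a b c k) (cong₂ _+_ (*ᴱ-comm a b k) (*ᴱ-comm a c k)))

  *ᴱ-·ᴱʳ : ∀ s a b → a *ᴱ (s ·ᴱ b) ≗ s ·ᴱ (a *ᴱ b)
  *ᴱ-·ᴱʳ s a b k = begin
    (a *ᴱ (s ·ᴱ b)) k
      ≡⟨ *ᴱ≡conv a (s ·ᴱ b) k ⟩
    ∑ N (λ j → ∑ N λ l → δ ((j ℕ.+ l) % N) q * (coeff a j * (s * coeff b l)))
      ≡⟨ ∑-cong N (λ j → ∑-cong N λ l → pull (δ ((j ℕ.+ l) % N) q) (coeff a j) s (coeff b l)) ⟩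
    ∑ N (λ j → ∑ N λ l → s * (δ ((j ℕ.+ l) % N) q * (coeff a j * coeff b l)))
      ≡⟨ ∑-*ˡ N s _ ⟨ trans ⟩ ∑-cong N (λ j → ∑-*ˡ N s _) ⟨
    s * conv a b q
      ≡⟨ cong (s *_) (*ᴱ≡conv a b k) ⟨
    (s ·ᴱ (a *ᴱ b)) k ∎
    where
    open ≡-Reasoning
    q = Fin.toℕ k
    pull : ∀ d x s y → d * (x * (s * y)) ≡ s * (d * (x * y))
    pull = solve-∀

  *ᴱ-·ᴱˡ : ∀ s a b → (s ·ᴱ a) *ᴱ b ≗ s ·ᴱ (a *ᴱ b)
  *ᴱ-·ᴱˡ s a b k = trans (*ᴱ-comm (s ·ᴱ a) b k) (trans (*ᴱ-·ᴱʳ s b a k) (cong (s *_) (*ᴱ-comm b a k)))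

  *ᴱ-zeroʳ : ∀ a → a *ᴱ 0ᴱ ≗ 0ᴱ
  *ᴱ-zeroʳ a k = trans (*ᴱ≡conv a 0ᴱ k) (∑-vanish N (λ j _ → ∑-vanish N λ l _ →
    trans (cong (δ ((j ℕ.+ l) % N) (Fin.toℕ k) *_) (ℤₚ.*-zeroʳ (coeff a j)))
          (ℤₚ.*-zeroʳ (δ ((j ℕ.+ l) % N) (Fin.toℕ k)))))

  *ᴱ-zeroˡ : ∀ a → 0ᴱ *ᴱ a ≗ 0ᴱ
  *ᴱ-zeroˡ a k = trans (*ᴱ-comm 0ᴱ a k) (*ᴱ-zeroʳ a k)

  *ᴱ-congˡ-≗ : ∀ {a a′} b → a ≗ a′ → a *ᴱ b ≗ a′ *ᴱ b
  *ᴱ-congˡ-≗ {a} {a′} b a≗a′ k = trans (*ᴱ≡conv a b k) (trans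
    (∑-cong N λ j → ∑-cong N λ l → cong (λ x → δ ((j ℕ.+ l) % N) (Fin.toℕ k) * (x * coeff b l)) (a≗a′ (idx j)))
    (sym (*ᴱ≡conv a′ b k)))

  *ᴱ-distribˡ--ᴱ : ∀ a b c → a *ᴱ (b -ᴱ c) ≗ a *ᴱ b -ᴱ a *ᴱ c
  *ᴱ-distribˡ--ᴱ a b c k = begin
    (a *ᴱ (b -ᴱ c)) k                       ≡⟨ *ᴱ-comm a (b -ᴱ c) k ⟩
    ((b -ᴱ c) *ᴱ a) k                       ≡⟨ *ᴱ-congˡ-≗ a (λ k → cong (b k +_) (sym (ℤₚ.-1*i≡-i (c k)))) k ⟩
    ((b +ᴱ (ℤ.-1ℤ ·ᴱ c)) *ᴱ a) k            ≡⟨ *ᴱ-distribʳ-+ᴱ a b (ℤ.-1ℤ ·ᴱ c) k ⟩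
    (b *ᴱ a) k + ((ℤ.-1ℤ ·ᴱ c) *ᴱ a) k      ≡⟨ cong₂ _+_ (*ᴱ-comm b a k) (*ᴱ-·ᴱˡ ℤ.-1ℤ c a k) ⟩
    (a *ᴱ b) k + ℤ.-1ℤ * (c *ᴱ a) k
      ≡⟨ cong ((a *ᴱ b) k +_) (trans (ℤₚ.-1*i≡-i _) (cong -_ (*ᴱ-comm c a k))) ⟩
    (a *ᴱ b -ᴱ a *ᴱ c) k                    ∎
    where open ≡-Reasoning

  ΣE-*ᴱ : ∀ n (f : Fin n → Elem) g → ΣE n f *ᴱ g ≗ ΣE n (λ s → f s *ᴱ g)
  ΣE-*ᴱ zero    f g k = *ᴱ-zeroˡ g k
  ΣE-*ᴱ (suc n) f g k = trans (*ᴱ-distribʳ-+ᴱ g (f Fin.zero) (ΣE n (f ∘ Fin.suc)) k)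
                              (cong ((f Fin.zero *ᴱ g) k +_) (ΣE-*ᴱ n (f ∘ Fin.suc) g k))

  coeff-σ^ : ∀ e q → coeff (σ^ e) q ≡ δ (q % N) (e % N)
  coeff-σ^ e q = cong (λ x → if x ℕ.≡ᵇ e % N then 1ℤ else 0ℤ) (toℕ-idx q)

  σ^-*ᴱ : ∀ e y k → (σ^ e *ᴱ y) k ≡ ∑ N (λ l → δ ((e % N ℕ.+ l) % N) (Fin.toℕ k) * coeff y l)
  σ^-*ᴱ e y k = begin
    (σ^ e *ᴱ y) k
      ≡⟨ *ᴱ≡conv (σ^ e) y k ⟩
    ∑ N (λ j → ∑ N λ l → δ ((j ℕ.+ l) % N) q * (coeff (σ^ e) j * coeff y l))
      ≡⟨ ∑-single N _ (m%n<n e N) (λ j j<N j≢e → ∑-vanish N λ l _ → off-support j j<N j≢e l) ⟩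
    ∑ N (λ l → δ ((e % N ℕ.+ l) % N) q * (coeff (σ^ e) (e % N) * coeff y l))
      ≡⟨ ∑-cong N (λ l → cong (δ ((e % N ℕ.+ l) % N) q *_) (on-support l)) ⟩
    ∑ N (λ l → δ ((e % N ℕ.+ l) % N) q * coeff y l) ∎
    where
    open ≡-Reasoning
    q = Fin.toℕ k
    off-support : ∀ j → j < N → j ≢ e % N → ∀ l → δ ((j ℕ.+ l) % N) q * (coeff (σ^ e) j * coeff y l) ≡ 0ℤ
    off-support j j<N j≢e l = begin
      δ ((j ℕ.+ l) % N) q * (coeff (σ^ e) j * coeff y l)
        ≡⟨ cong (λ x → δ ((j ℕ.+ l) % N) q * (x * coeff y l))
                (trans (coeff-σ^ e j) (cong (λ x → δ x (e % N)) (m<n⇒m%n≡m j<N))) ⟩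
      δ ((j ℕ.+ l) % N) q * (δ j (e % N) * coeff y l)
        ≡⟨ cong (δ ((j ℕ.+ l) % N) q *_) (δ-*-zero j≢e (coeff y l)) ⟩
      δ ((j ℕ.+ l) % N) q * 0ℤ
        ≡⟨ ℤₚ.*-zeroʳ (δ ((j ℕ.+ l) % N) q) ⟩
      0ℤ ∎
    on-support : ∀ l → coeff (σ^ e) (e % N) * coeff y l ≡ coeff y l
    on-support l = trans (cong (_* coeff y l) (coeff-σ^ e (e % N))) (δ-*-one (m%n%n≡m%n e N) (coeff y l))

  coeff-σ^-*ᴱ-< : ∀ e y {l} → l < N → coeff (σ^ e *ᴱ y) (e ℕ.+ l) ≡ coeff y l
  coeff-σ^-*ᴱ-< e y {l₀} l₀<N = begin
    coeff (σ^ e *ᴱ y) (e ℕ.+ l₀)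
      ≡⟨ σ^-*ᴱ e y (idx (e ℕ.+ l₀)) ⟩
    ∑ N (λ l → δ ((e % N ℕ.+ l) % N) q * coeff y l)
      ≡⟨ ∑-single N _ l₀<N (λ l l<N l≢l₀ → δ-*-zero (l≢l₀ ∘ shifts-differ l<N) (coeff y l)) ⟩
    δ ((e % N ℕ.+ l₀) % N) q * coeff y l₀
      ≡⟨ δ-*-one (trans ([m%d+n]%d≡[m+n]%d e l₀ N) (sym (toℕ-idx (e ℕ.+ l₀)))) (coeff y l₀) ⟩
    coeff y l₀ ∎
    where
    open ≡-Reasoning
    q = Fin.toℕ (idx (e ℕ.+ l₀))
    shifts-differ : ∀ {l} → l < N → (e % N ℕ.+ l) % N ≡ q → l ≡ l₀
    shifts-differ {l} l<N eq = [m+n]%d-injective e N l<N l₀<N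
      (trans (sym ([m%d+n]%d≡[m+n]%d e l N)) (trans eq (toℕ-idx (e ℕ.+ l₀))))

  coeff-σ^-*ᴱ : ∀ e y q → coeff (σ^ e *ᴱ y) (e ℕ.+ q) ≡ coeff y q
  coeff-σ^-*ᴱ e y q = begin
    coeff (σ^ e *ᴱ y) (e ℕ.+ q)      ≡⟨ coeff-cong (σ^ e *ᴱ y) ([m+n%d]%d≡[m+n]%d e q N) ⟨
    coeff (σ^ e *ᴱ y) (e ℕ.+ q % N)  ≡⟨ coeff-σ^-*ᴱ-< e y (m%n<n q N) ⟩
    coeff y (q % N)                  ≡⟨ coeff-cong y (m%n%n≡m%n q N) ⟩
    coeff y q                        ∎
    where open ≡-Reasoning

  1ᴱ-*ᴱ : ∀ y → 1ᴱ *ᴱ y ≗ y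
  1ᴱ-*ᴱ y k = begin
    (1ᴱ *ᴱ y) k                       ≡⟨ cong (1ᴱ *ᴱ y) (idx-toℕ k) ⟨
    coeff (1ᴱ *ᴱ y) (0 ℕ.+ Fin.toℕ k) ≡⟨ coeff-σ^-*ᴱ-< 0 y (Finₚ.toℕ<n k) ⟩
    coeff y (Fin.toℕ k)               ≡⟨ coeff-toℕ y k ⟩
    y k                               ∎
    where open ≡-Reasoning

  σ^-*ᴱ-σ^ : ∀ a b → σ^ a *ᴱ σ^ b ≗ σ^ (a ℕ.+ b)
  σ^-*ᴱ-σ^ a b k = begin
    (σ^ a *ᴱ σ^ b) k
      ≡⟨ σ^-*ᴱ a (σ^ b) k ⟩
    ∑ N (λ l → δ ((a % N ℕ.+ l) % N) q * coeff (σ^ b) l)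
      ≡⟨ ∑-single N _ (m%n<n b N) (λ l l<N l≢b →
           trans (cong (δ ((a % N ℕ.+ l) % N) q *_) (coeff-σ^-off l<N l≢b))
                 (ℤₚ.*-zeroʳ (δ ((a % N ℕ.+ l) % N) q))) ⟩
    δ ((a % N ℕ.+ b % N) % N) q * coeff (σ^ b) (b % N)
      ≡⟨ cong (δ ((a % N ℕ.+ b % N) % N) q *_) (trans (coeff-σ^ b (b % N)) (δ-≡ (m%n%n≡m%n b N))) ⟩
    δ ((a % N ℕ.+ b % N) % N) q * 1ℤ
      ≡⟨ ℤₚ.*-identityʳ _ ⟩
    δ ((a % N ℕ.+ b % N) % N) q
      ≡⟨ cong (λ x → δ x q) (trans ([m%d+n]%d≡[m+n]%d a (b % N) N) ([m+n%d]%d≡[m+n]%d a b N)) ⟩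
    δ ((a ℕ.+ b) % N) q
      ≡⟨ δ-sym ((a ℕ.+ b) % N) q ⟩
    σ^ (a ℕ.+ b) k ∎
    where
    open ≡-Reasoning
    q = Fin.toℕ k
    coeff-σ^-off : ∀ {l} → l < N → l ≢ b % N → coeff (σ^ b) l ≡ 0ℤ
    coeff-σ^-off {l} l<N l≢b = trans (coeff-σ^ b l) (δ-≢ (l≢b ∘ trans (sym (m<n⇒m%n≡m l<N))))

  -- The equality _≈_ of R_m G_i, wrapped in a record so that its arguments can be inferred.
  infix 4 _≋_
  record _≋_ (a b : Elem) : Set where
    constructor ≈⇒≋
    field
      ≋⇒≈ : a ≈ b

  open _≋_

  ≋⇒≡-mod : ∀ {a b} → a ≋ b → ∀ k → a k ≡ b k [mod ℤ.+ M ]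
  ≋⇒≡-mod (≈⇒≋ a≈b) k = ≡-mod (ℤ∣.∣ᵤ⇒∣ (a≈b k))

  ≡-mod⇒≋ : ∀ {a b} → (∀ k → a k ≡ b k [mod ℤ.+ M ]) → a ≋ b
  ≡-mod⇒≋ a≡b = ≈⇒≋ λ k → ℤ∣.∣⇒∣ᵤ (divides-difference (a≡b k))

  ≗⇒≋ : ∀ {a b} → a ≗ b → a ≋ b
  ≗⇒≋ a≗b = ≡-mod⇒≋ λ k → ≡⇒≡-mod (a≗b k)

  +ᴱ-isAbelianGroup : IsAbelianGroup _≋_ _+ᴱ_ 0ᴱ (λ a k → - a k)
  +ᴱ-isAbelianGroup = record
    { isGroup = record
      { isMonoid = record
        { isSemigroup = record
          { isMagma = record
            { isEquivalence = record
              { refl  = ≗⇒≋ λ _ → refl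
              ; sym   = λ a≋b → ≡-mod⇒≋ λ k → ≡-mod-sym (≋⇒≡-mod a≋b k)
              ; trans = λ a≋b b≋c → ≡-mod⇒≋ λ k → ≡-mod-trans (≋⇒≡-mod a≋b k) (≋⇒≡-mod b≋c k)
              }
            ; ∙-cong = λ a≋a′ b≋b′ → ≡-mod⇒≋ λ k → ≡-mod-+ (≋⇒≡-mod a≋a′ k) (≋⇒≡-mod b≋b′ k)
            }
          ; assoc = λ a b c → ≗⇒≋ λ k → ℤₚ.+-assoc (a k) (b k) (c k)
          }
        ; identity = (λ a → ≗⇒≋ λ k → ℤₚ.+-identityˡ (a k)) , (λ a → ≗⇒≋ λ k → ℤₚ.+-identityʳ (a k))
        }
      ; inverse = (λ a → ≗⇒≋ λ k → ℤₚ.+-inverseˡ (a k)) , (λ a → ≗⇒≋ λ k → ℤₚ.+-inverseʳ (a k))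
      ; ⁻¹-cong = λ a≋a′ → ≡-mod⇒≋ λ k → ≡-mod-neg (≋⇒≡-mod a≋a′ k)
      }
    ; comm = λ a b → ≗⇒≋ λ k → ℤₚ.+-comm (a k) (b k)
    }

  private
    module ≋ = IsAbelianGroup +ᴱ-isAbelianGroup

  ≋-decompose : ∀ {a a′} → a ≋ a′ → Σ Elem λ u → a ≗ a′ +ᴱ ℤ.+ M ·ᴱ u
  ≋-decompose a≋a′ = (λ k → ≡-mod-quotient (≋⇒≡-mod a≋a′ k)) , λ k → ≡-mod⇒≡+* (≋⇒≡-mod a≋a′ k)

  +ᴱ-M·ᴱ-≋ : ∀ a u → a +ᴱ ℤ.+ M ·ᴱ u ≋ a
  +ᴱ-M·ᴱ-≋ a u = ≡-mod⇒≋ λ k → ≡-mod (divides (u k) (regroup (a k) (u k) (ℤ.+ M)))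
    where
    regroup : ∀ a u d → a + d * u - a ≡ u * d
    regroup = solve-∀

  *ᴱ-congˡ : ∀ {a a′} b → a ≋ a′ → a *ᴱ b ≋ a′ *ᴱ b
  *ᴱ-congˡ {a} {a′} b a≋a′ = ≋.trans (≗⇒≋ a*b≗a′*b+M·ub) (+ᴱ-M·ᴱ-≋ (a′ *ᴱ b) (u *ᴱ b))
    where
    u = proj₁ (≋-decompose a≋a′)
    a*b≗a′*b+M·ub : a *ᴱ b ≗ a′ *ᴱ b +ᴱ ℤ.+ M ·ᴱ (u *ᴱ b)
    a*b≗a′*b+M·ub k = trans (*ᴱ-congˡ-≗ b (proj₂ (≋-decompose a≋a′)) k)
      (trans (*ᴱ-distribʳ-+ᴱ b a′ (ℤ.+ M ·ᴱ u) k) (cong ((a′ *ᴱ b) k +_) (*ᴱ-·ᴱˡ (ℤ.+ M) u b k)))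

  *ᴱ-congʳ : ∀ a {b b′} → b ≋ b′ → a *ᴱ b ≋ a *ᴱ b′
  *ᴱ-congʳ a {b} {b′} b≋b′ =
    ≋.trans (≗⇒≋ (*ᴱ-comm a b)) (≋.trans (*ᴱ-congˡ a b≋b′) (≗⇒≋ (*ᴱ-comm b′ a)))

  groupRing : CommutativeRing 0ℓ 0ℓ
  groupRing = record
    { Carrier = Elem
    ; _≈_ = _≋_
    ; _+_ = _+ᴱ_
    ; _*_ = _*ᴱ_
    ; -_ = λ a k → - a k
    ; 0# = 0ᴱ
    ; 1# = 1ᴱ
    ; isCommutativeRing = record
      { isRing = record
        { +-isAbelianGroup = +ᴱ-isAbelianGroup
        ; *-cong = λ {a} {a′} {b} a≋a′ b≋b′ → ≋.trans (*ᴱ-congˡ b a≋a′) (*ᴱ-congʳ a′ b≋b′)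
        ; *-assoc = λ a b c → ≗⇒≋ (*ᴱ-assoc a b c)
        ; *-identity = (λ a → ≗⇒≋ (1ᴱ-*ᴱ a))
                     , (λ a → ≗⇒≋ (λ k → trans (*ᴱ-comm a 1ᴱ k) (1ᴱ-*ᴱ a k)))
        ; distrib = (λ a b c → ≗⇒≋ (*ᴱ-distribˡ-+ᴱ a b c))
                  , (λ a b c → ≗⇒≋ (*ᴱ-distribʳ-+ᴱ a b c))
        }
      ; *-comm = λ a b → ≗⇒≋ (*ᴱ-comm a b)
      }
    }

  module R = CommutativeRing groupRing
  open Ideal groupRing

  ∈⟨⟩⇒∈Ideal : ∀ {x} gs → x ∈⟨ gs ⟩ → x ∈Ideal gs
  ∈⟨⟩⇒∈Ideal []       (r , x≈0)     = ∈[] (≈⇒≋ x≈0)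
  ∈⟨⟩⇒∈Ideal (g ∷ gs) (r , x≈rg+x′) =
    ∈∷ (r Fin.zero) x′ (≈⇒≋ x≈rg+x′) (∈⟨⟩⇒∈Ideal gs (r ∘ Fin.suc , ≋⇒≈ (R.refl {x′})))
    where
    x′ = ΣE (length gs) (λ k → r (Fin.suc k) *ᴱ lookup gs k)

  ∈Ideal⇒∈⟨⟩ : ∀ {x gs} → x ∈Ideal gs → x ∈⟨ gs ⟩
  ∈Ideal⇒∈⟨⟩ (∈[] x≋0) = (λ ()) , ≋⇒≈ x≋0
  ∈Ideal⇒∈⟨⟩ (∈∷ {g = g} {gs} r x′ x≋rg+x′ x′∈gs) with ∈Ideal⇒∈⟨⟩ x′∈gs
  ... | r′ , x′≈Σ = r Vec.∷ r′ , ≋⇒≈ (R.trans x≋rg+x′ (R.+-congˡ {r *ᴱ g} (≈⇒≋ {x′} {Σr′gs} x′≈Σ)))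
    where
    Σr′gs = ΣE (length gs) (λ k → r′ k *ᴱ lookup gs k)

  AnnEq-intro : ∀ gs hs → (∀ x → Annihilates x gs → x ∈Ideal hs) →
                All (λ h → Annihilates h gs) hs → AnnEq gs hs
  AnnEq-intro gs hs ann⊆ ⊆ann x = ann⇒∈ , ∈⇒ann
    where
    ann⇒∈ : x ∈ann⟨ gs ⟩ → x ∈⟨ hs ⟩
    ann⇒∈ x-ann = ∈Ideal⇒∈⟨⟩ (ann⊆ x (annihilates-generators {x} gs λ {y} y∈gs →
                                         ≈⇒≋ (x-ann y (∈Ideal⇒∈⟨⟩ y∈gs))))
    ∈⇒ann : x ∈⟨ hs ⟩ → x ∈ann⟨ gs ⟩
    ∈⇒ann x∈hs y y∈gs =
      ≋⇒≈ (annihilators-annihilate {hs} {gs} {x} {y} ⊆ann (∈⟨⟩⇒∈Ideal hs x∈hs) (∈⟨⟩⇒∈Ideal gs y∈gs))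

  private module ≈-Reasoning = SetoidReasoning R.setoid
  open import Algebra.Properties.CommutativeSemigroup R.*-commutativeSemigroup using (interchange)

  -- The kernel of σ^(p^c) − 1

  p^[i∸c]*p^c≡N : ∀ {c} → c ≤ i → p ^ (i ∸ c) ℕ.* p ^ c ≡ N
  p^[i∸c]*p^c≡N {c} c≤i = trans (sym (ℕₚ.^-distribˡ-+-* p (i ∸ c) c)) (cong (p ^_) (ℕₚ.m∸n+n≡m c≤i))

  P-*ᴱ-σ^ : ∀ {c c′} → c ≤ i → c ≤ c′ → P (fin c) *ᴱ σ^ (p ^ c′) ≗ P (fin c)
  P-*ᴱ-σ^ {c} {c′} c≤i c≤c′ k = begin
    (P (fin c) *ᴱ σ^ (p ^ c′)) k
      ≡⟨ ΣE-*ᴱ n (λ s → σ^ (Fin.toℕ s ℕ.* e)) (σ^ (p ^ c′)) k ⟩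
    ΣE n (λ s → σ^ (Fin.toℕ s ℕ.* e) *ᴱ σ^ (p ^ c′)) k
      ≡⟨ ΣE-apply n _ k ⟩
    ΣZ n (λ s → (σ^ (Fin.toℕ s ℕ.* e) *ᴱ σ^ (p ^ c′)) k)
      ≡⟨ ΣZ≡∑ n _ (λ s → f (s ℕ.+ u)) (λ s → trans (σ^-*ᴱ-σ^ _ _ k) (cong (λ x → σ^ x k) (shift (Fin.toℕ s)))) ⟩
    ∑ n (λ s → f (s ℕ.+ u))
      ≡⟨ ∑-rotate n f periodic u ⟩
    ∑ n f
      ≡⟨ ΣZ≡∑ n _ f (λ _ → refl) ⟨
    ΣZ n (λ s → σ^ (Fin.toℕ s ℕ.* e) k)
      ≡⟨ ΣE-apply n _ k ⟨
    P (fin c) k ∎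
    where
    open ≡-Reasoning
    n = p ^ (i ∸ c)
    e = p ^ c
    u = p ^ (c′ ∸ c)
    f : ℕ → ℤ
    f s = σ^ (s ℕ.* e) k
    shift : ∀ s → s ℕ.* e ℕ.+ p ^ c′ ≡ (s ℕ.+ u) ℕ.* e
    shift s = begin
      s ℕ.* e ℕ.+ p ^ c′               ≡⟨ cong (λ x → s ℕ.* e ℕ.+ p ^ x) (ℕₚ.m∸n+n≡m c≤c′) ⟨
      s ℕ.* e ℕ.+ p ^ (c′ ∸ c ℕ.+ c)   ≡⟨ cong (s ℕ.* e ℕ.+_) (ℕₚ.^-distribˡ-+-* p (c′ ∸ c) c) ⟩
      s ℕ.* e ℕ.+ u ℕ.* e              ≡⟨ ℕₚ.*-distribʳ-+ e s u ⟨
      (s ℕ.+ u) ℕ.* e                  ∎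
    periodic : ∀ s → f (s ℕ.+ n) ≡ f s
    periodic s = cong (λ x → if Fin.toℕ k ℕ.≡ᵇ x then 1ℤ else 0ℤ) (begin
      (s ℕ.+ n) ℕ.* e % N          ≡⟨ cong (_% N) (ℕₚ.*-distribʳ-+ e s n) ⟩
      (s ℕ.* e ℕ.+ n ℕ.* e) % N    ≡⟨ cong (λ x → (s ℕ.* e ℕ.+ x) % N) (p^[i∸c]*p^c≡N c≤i) ⟩
      (s ℕ.* e ℕ.+ N) % N          ≡⟨ [m+n]%n≡m%n (s ℕ.* e) N ⟩
      s ℕ.* e % N                  ∎)

  P-*ᴱ-σ^-1 : ∀ {c c′} → c ≤ i → c ≤ c′ → P (fin c) *ᴱ (σ^ (p ^ c′) -ᴱ 1ᴱ) ≋ 0ᴱ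
  P-*ᴱ-σ^-1 {c} {c′} c≤i c≤c′ = ≗⇒≋ λ k → begin
    (P (fin c) *ᴱ (σ^ (p ^ c′) -ᴱ 1ᴱ)) k      ≡⟨ *ᴱ-distribˡ--ᴱ (P (fin c)) (σ^ (p ^ c′)) 1ᴱ k ⟩
    (P (fin c) *ᴱ σ^ (p ^ c′)) k - (P (fin c) *ᴱ 1ᴱ) k
      ≡⟨ cong₂ _-_ (P-*ᴱ-σ^ c≤i c≤c′ k) (trans (*ᴱ-comm (P (fin c)) 1ᴱ k) (1ᴱ-*ᴱ (P (fin c)) k)) ⟩
    P (fin c) k - P (fin c) k                 ≡⟨ ℤₚ.+-inverseʳ (P (fin c) k) ⟩
    0ℤ                                        ∎
    where open ≡-Reasoning

  truncate : ℕ → Elem → Elem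
  truncate e y k = if Fin.toℕ k ℕ.<ᵇ e then y k else 0ℤ

  coeff-truncate-< : ∀ e y {q} → q < N → q < e → coeff (truncate e y) q ≡ coeff y q
  coeff-truncate-< e y {q} q<N q<e with Fin.toℕ (idx q) ℕ.<ᵇ e in eq
  ... | true  = refl
  ... | false = ⊥-elim (subst T eq (ℕₚ.<⇒<ᵇ (subst (_< e) (sym (trans (toℕ-idx q) (m<n⇒m%n≡m q<N))) q<e)))

  coeff-truncate-≥ : ∀ e y {q} → q < N → e ≤ q → coeff (truncate e y) q ≡ 0ℤ
  coeff-truncate-≥ e y {q} q<N e≤q with Fin.toℕ (idx q) ℕ.<ᵇ e in eq
  ... | true  = ⊥-elim (ℕₚ.<⇒≱ (subst (_< e) (trans (toℕ-idx q) (m<n⇒m%n≡m q<N))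
                                       (ℕₚ.<ᵇ⇒< _ e (subst T (sym eq) tt))) e≤q)
  ... | false = refl

  P-*ᴱ-truncate : ∀ {c} → c ≤ i → ∀ y k →
    let instance _ = ℕₚ.m^n≢0 p c {{nz}} in
    (P (fin c) *ᴱ truncate (p ^ c) y) k ≡ coeff y (Fin.toℕ k % p ^ c)
  P-*ᴱ-truncate {c} c≤i y k = begin
    (P (fin c) *ᴱ z) k
      ≡⟨ ΣE-*ᴱ n (λ s → σ^ (Fin.toℕ s ℕ.* e)) z k ⟩
    ΣE n (λ s → σ^ (Fin.toℕ s ℕ.* e) *ᴱ z) k
      ≡⟨ ΣE-apply n _ k ⟩
    ΣZ n (λ s → (σ^ (Fin.toℕ s ℕ.* e) *ᴱ z) k)
      ≡⟨ ΣZ≡∑ n _ (λ s → (σ^ (s ℕ.* e) *ᴱ z) k) (λ _ → refl) ⟩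
    ∑ n (λ s → (σ^ (s ℕ.* e) *ᴱ z) k)
      ≡⟨ ∑-cong-< n (λ s s<n → trans (σ^-*ᴱ (s ℕ.* e) z k) (block s s<n)) ⟩
    ∑ n (λ s → ∑ e (λ l → G (s ℕ.* e ℕ.+ l)))
      ≡⟨ ∑-blocks n e G ⟨
    ∑ (n ℕ.* e) G
      ≡⟨ cong (λ x → ∑ x G) n*e≡N ⟩
    ∑ N G
      ≡⟨ ∑-single N G (Finₚ.toℕ<n k) (λ t _ t≢q → δ-*-zero t≢q (coeff y (t % e))) ⟩
    G q
      ≡⟨ δ-*-one {q} refl (coeff y (q % e)) ⟩
    coeff y (q % e) ∎
    where
    open ≡-Reasoning
    instance _ = ℕₚ.m^n≢0 p c {{nz}}
    n = p ^ (i ∸ c)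
    e = p ^ c
    z = truncate e y
    q = Fin.toℕ k
    n*e≡N : n ℕ.* e ≡ N
    n*e≡N = p^[i∸c]*p^c≡N c≤i
    G : ℕ → ℤ
    G t = δ t q * coeff y (t % e)
    e≤N : e ≤ N
    e≤N = subst (e ≤_) n*e≡N (ℕₚ.m≤n*m e n {{ℕₚ.m^n≢0 p (i ∸ c) {{nz}}}})
    in-range : ∀ {s l} → s < n → l < e → s ℕ.* e ℕ.+ l < N
    in-range {s} {l} s<n l<e = subst (s ℕ.* e ℕ.+ l <_) n*e≡N (ℕₚ.<-≤-trans (ℕₚ.+-monoʳ-< (s ℕ.* e) l<e)
      (subst (_≤ n ℕ.* e) (ℕₚ.+-comm e (s ℕ.* e)) (ℕₚ.*-monoˡ-≤ e s<n)))
    block : ∀ s → s < n → ∑ N (λ l → δ ((s ℕ.* e % N ℕ.+ l) % N) q * coeff z l) ≡ ∑ e (λ l → G (s ℕ.* e ℕ.+ l))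
    block s s<n = begin
      ∑ N (λ l → δ ((s ℕ.* e % N ℕ.+ l) % N) q * coeff z l)
        ≡⟨ ∑-truncate _ e≤N (λ l e≤l l<N → trans (cong (δ ((s ℕ.* e % N ℕ.+ l) % N) q *_)
                                                       (coeff-truncate-≥ e y l<N e≤l))
                                                 (ℤₚ.*-zeroʳ (δ ((s ℕ.* e % N ℕ.+ l) % N) q))) ⟩
      ∑ e (λ l → δ ((s ℕ.* e % N ℕ.+ l) % N) q * coeff z l)
        ≡⟨ ∑-cong-< e (λ l l<e → cong₂ _*_
             (cong (λ x → δ x q) (trans ([m%d+n]%d≡[m+n]%d (s ℕ.* e) l N) (m<n⇒m%n≡m (in-range s<n l<e))))
             (trans (coeff-truncate-< e y (ℕₚ.<-≤-trans l<e e≤N) l<e)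
                    (cong (coeff y) (sym (trans (cong (_% e) (ℕₚ.+-comm (s ℕ.* e) l))
                                                (trans ([m+kn]%n≡m%n l s e) (m<n⇒m%n≡m l<e))))))) ⟩
      ∑ e (λ l → G (s ℕ.* e ℕ.+ l)) ∎

  coeff-*ᴱ-σ^-1 : ∀ e y q → coeff (y *ᴱ (σ^ e -ᴱ 1ᴱ)) (e ℕ.+ q) ≡ coeff y q - coeff y (e ℕ.+ q)
  coeff-*ᴱ-σ^-1 e y q = begin
    coeff (y *ᴱ (σ^ e -ᴱ 1ᴱ)) (e ℕ.+ q)
      ≡⟨ *ᴱ-distribˡ--ᴱ y (σ^ e) 1ᴱ (idx (e ℕ.+ q)) ⟩
    coeff (y *ᴱ σ^ e) (e ℕ.+ q) - coeff (y *ᴱ 1ᴱ) (e ℕ.+ q)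
      ≡⟨ cong₂ _-_ (*ᴱ-comm y (σ^ e) (idx (e ℕ.+ q))) (trans (*ᴱ-comm y 1ᴱ _) (1ᴱ-*ᴱ y _)) ⟩
    coeff (σ^ e *ᴱ y) (e ℕ.+ q) - coeff y (e ℕ.+ q)
      ≡⟨ cong (_- coeff y (e ℕ.+ q)) (coeff-σ^-*ᴱ e y q) ⟩
    coeff y q - coeff y (e ℕ.+ q) ∎
    where open ≡-Reasoning

  σ^-1-kernel : ∀ {c} d y → c ≤ i → (∀ k → d ∣ (y *ᴱ (σ^ (p ^ c) -ᴱ 1ᴱ)) k) →
                Σ Elem λ z → Σ Elem λ w → y ≗ P (fin c) *ᴱ z +ᴱ d ·ᴱ w
  σ^-1-kernel {c} d y c≤i d∣ = truncate e y , w , y≗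
    where
    instance _ = ℕₚ.m^n≢0 p c {{nz}}
    e = p ^ c
    period : ∀ q → coeff y (e ℕ.+ q) ≡ coeff y q [mod d ]
    period q = ≡-mod-sym (≡-mod (subst (d ∣_) (coeff-*ᴱ-σ^-1 e y q) (d∣ (idx (e ℕ.+ q)))))
    residue : ∀ k → y k ≡ (P (fin c) *ᴱ truncate e y) k [mod d ]
    residue k = subst₂ (λ x x′ → x ≡ x′ [mod d ]) (coeff-toℕ y k) (sym (P-*ᴱ-truncate c≤i y k))
                       (periodic-≡-mod e (coeff y) period (Fin.toℕ k))
    w : Elem
    w k = ≡-mod-quotient (residue k)
    y≗ : y ≗ P (fin c) *ᴱ truncate e y +ᴱ d ·ᴱ w
    y≗ k = ≡-mod⇒≡+* (residue k)

  pᶻ : ℕ → ℤ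
  pᶻ e = ℤ.+ (p ^ e)

  pᶻ-+ : ∀ a b → pᶻ a * pᶻ b ≡ pᶻ (a ℕ.+ b)
  pᶻ-+ a b = trans (sym (ℤₚ.pos-* (p ^ a) (p ^ b))) (cong ℤ.+_ (sym (ℕₚ.^-distribˡ-+-* p a b)))

  pᶻ-∣ : ∀ {a b} → a ≤ b → pᶻ a ∣ pᶻ b
  pᶻ-∣ {a} {b} a≤b = divides (pᶻ (b ∸ a)) (trans (cong pᶻ (sym (ℕₚ.m∸n+n≡m a≤b))) (sym (pᶻ-+ (b ∸ a) a)))

  pᶻ-cancel : ∀ a k x → pᶻ (a ℕ.+ k) ∣ pᶻ a * x → pᶻ k ∣ x
  pᶻ-cancel a k x p^[a+k]∣p^a*x =
    ℤ∣.*-cancelˡ-∣ (pᶻ a) {{ℕₚ.m^n≢0 p a {{nz}}}} (subst (_∣ pᶻ a * x) (sym (pᶻ-+ a k)) p^[a+k]∣p^a*x)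

  pw-*ᴱ : ∀ e y → pw e *ᴱ y ≗ pᶻ e ·ᴱ y
  pw-*ᴱ e y k = trans (*ᴱ-·ᴱˡ (pᶻ e) 1ᴱ y k) (cong (pᶻ e *_) (1ᴱ-*ᴱ y k))

  ·ᴱ-·ᴱ : ∀ s t y → s ·ᴱ (t ·ᴱ y) ≗ (s * t) ·ᴱ y
  ·ᴱ-·ᴱ s t y k = sym (ℤₚ.*-assoc s t (y k))

  pw-*ᴱ-pᶻ·ᴱ : ∀ a b w → pw a *ᴱ (pᶻ b ·ᴱ w) ≗ pw (a ℕ.+ b) *ᴱ w
  pw-*ᴱ-pᶻ·ᴱ a b w k = begin
    (pw a *ᴱ (pᶻ b ·ᴱ w)) k   ≡⟨ pw-*ᴱ a (pᶻ b ·ᴱ w) k ⟩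
    pᶻ a * (pᶻ b * w k)       ≡⟨ ·ᴱ-·ᴱ (pᶻ a) (pᶻ b) w k ⟩
    pᶻ a * pᶻ b * w k         ≡⟨ cong (_* w k) (pᶻ-+ a b) ⟩
    pᶻ (a ℕ.+ b) * w k        ≡⟨ pw-*ᴱ (a ℕ.+ b) w k ⟨
    (pw (a ℕ.+ b) *ᴱ w) k     ∎
    where open ≡-Reasoning

  pw-*ᴱ-pw : ∀ a b → pw a *ᴱ pw b ≗ pw (a ℕ.+ b)
  pw-*ᴱ-pw a b k = trans (pw-*ᴱ a (pw b) k) (trans (·ᴱ-·ᴱ (pᶻ a) (pᶻ b) 1ᴱ k) (cong (_* 1ᴱ k) (pᶻ-+ a b)))

  pw-0-*ᴱ : ∀ y → pw 0 *ᴱ y ≋ y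
  pw-0-*ᴱ y = ≗⇒≋ λ k → trans (pw-*ᴱ 0 y k) (ℤₚ.*-identityˡ (y k))

  pw≋pw*1 : ∀ a → pw a ≋ pw a *ᴱ 1ᴱ
  pw≋pw*1 a = R.sym (R.*-identityʳ (pw a))

  pw-split : ∀ {a b} u → b ≤ a → pw a *ᴱ u ≋ pw b *ᴱ (pw (a ∸ b) *ᴱ u)
  pw-split {a} {b} u b≤a = begin
    pw a *ᴱ u                      ≈⟨ ≗⇒≋ (λ k → cong (λ e → (pw e *ᴱ u) k) (sym (ℕₚ.m+[n∸m]≡n b≤a))) ⟩
    pw (b ℕ.+ (a ∸ b)) *ᴱ u        ≈⟨ R.*-congʳ {u} (≗⇒≋ (pw-*ᴱ-pw b (a ∸ b))) ⟨
    (pw b *ᴱ pw (a ∸ b)) *ᴱ u      ≈⟨ R.*-assoc (pw b) (pw (a ∸ b)) u ⟩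
    pw b *ᴱ (pw (a ∸ b) *ᴱ u)      ∎
    where open ≈-Reasoning

  ·ᴱ-≋0 : ∀ s y → ℤ.+ M ∣ s → s ·ᴱ y ≋ 0ᴱ
  ·ᴱ-≋0 s y M∣s = ≡-mod⇒≋ λ k →
    ≡-mod (subst (ℤ.+ M ∣_) (sym (ℤₚ.+-identityʳ (s * y k))) (ℤ∣.∣m⇒∣m*n (y k) M∣s))

  ·ᴱ-≋0⇒∣ : ∀ e y → pᶻ e ·ᴱ y ≋ 0ᴱ → e ≤ m → ∀ k → pᶻ (m ∸ e) ∣ y k
  ·ᴱ-≋0⇒∣ e y ≋0 e≤m k = pᶻ-cancel e (m ∸ e) (y k)
    (subst (λ x → pᶻ x ∣ pᶻ e * y k) (sym (ℕₚ.m+[n∸m]≡n e≤m))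
           (subst (ℤ.+ M ∣_) (ℤₚ.+-identityʳ _) (divides-difference (≋⇒≡-mod ≋0 k))))

  ∣-coeff⇒·ᴱ : ∀ s x → (∀ k → s ∣ x k) → Σ Elem λ y → x ≗ s ·ᴱ y
  ∣-coeff⇒·ᴱ s x s∣x = (λ k → _∣_.quotient (s∣x k)) , λ k → trans (_∣_.equality (s∣x k)) (ℤₚ.*-comm _ s)

  pw-*ᴱ-pw-*ᴱ : ∀ a b u v → (pw a *ᴱ u) *ᴱ (pw b *ᴱ v) ≋ pᶻ (a ℕ.+ b) ·ᴱ (u *ᴱ v)
  pw-*ᴱ-pw-*ᴱ a b u v = begin
    (pw a *ᴱ u) *ᴱ (pw b *ᴱ v)    ≈⟨ interchange (pw a) u (pw b) v ⟩
    (pw a *ᴱ pw b) *ᴱ (u *ᴱ v)    ≈⟨ ≗⇒≋ (*ᴱ-congˡ-≗ (u *ᴱ v) (pw-*ᴱ-pw a b)) ⟩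
    pw (a ℕ.+ b) *ᴱ (u *ᴱ v)      ≈⟨ ≗⇒≋ (pw-*ᴱ (a ℕ.+ b) (u *ᴱ v)) ⟩
    pᶻ (a ℕ.+ b) ·ᴱ (u *ᴱ v)      ∎
    where open ≈-Reasoning

  pw-multiples-annihilate : ∀ a b {h g} v u → m ≤ a ℕ.+ b →
                            h ≋ pw a *ᴱ v → g ≋ pw b *ᴱ u → h *ᴱ g ≋ 0ᴱ
  pw-multiples-annihilate a b {h} {g} v u m≤a+b h≋ g≋ = begin
    h *ᴱ g                        ≈⟨ R.*-cong h≋ g≋ ⟩
    (pw a *ᴱ v) *ᴱ (pw b *ᴱ u)    ≈⟨ pw-*ᴱ-pw-*ᴱ a b v u ⟩
    pᶻ (a ℕ.+ b) ·ᴱ (v *ᴱ u)      ≈⟨ ·ᴱ-≋0 (pᶻ (a ℕ.+ b)) (v *ᴱ u) (pᶻ-∣ m≤a+b) ⟩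
    0ᴱ                            ∎
    where open ≈-Reasoning

  pw-complement-annihilates : ∀ b w → b ≤ m → (pw (m ∸ b) *ᴱ w) *ᴱ pw b ≋ 0ᴱ
  pw-complement-annihilates b w b≤m =
    pw-multiples-annihilate (m ∸ b) b w 1ᴱ (ℕₚ.≤-reflexive (sym (ℕₚ.m∸n+n≡m b≤m))) R.refl (pw≋pw*1 b)

  annihilator-pw : ∀ x b → b ≤ m → x *ᴱ pw b ≋ 0ᴱ → Σ Elem λ y → x ≋ pw (m ∸ b) *ᴱ y
  annihilator-pw x b b≤m x*p^b≋0 = y , ≗⇒≋ (λ k → trans (x≗ k) (sym (pw-*ᴱ (m ∸ b) y k)))
    where
    p^b·x≋0 : pᶻ b ·ᴱ x ≋ 0ᴱ
    p^b·x≋0 = begin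
      pᶻ b ·ᴱ x   ≈⟨ ≗⇒≋ (λ k → sym (pw-*ᴱ b x k)) ⟩
      pw b *ᴱ x   ≈⟨ R.*-comm (pw b) x ⟩
      x *ᴱ pw b   ≈⟨ x*p^b≋0 ⟩
      0ᴱ          ∎
      where open ≈-Reasoning
    x=p^[m∸b]·y = ∣-coeff⇒·ᴱ (pᶻ (m ∸ b)) x (·ᴱ-≋0⇒∣ b x p^b·x≋0 b≤m)
    y = proj₁ x=p^[m∸b]·y
    x≗ = proj₂ x=p^[m∸b]·y

  -- Annihilators of the generators

  gen : ℕ → Exp → Elem
  gen b e = pw b *ᴱ (σ^p^ e -ᴱ 1ᴱ)

  -- Stated for an exponent e ≡ fin c so that it applies to the c j of a chain without rewriting.
  annihilator-gen : ∀ a b {e c} y → e ≡ fin c → c ≤ i → a ℕ.+ b ≤ m → (pw a *ᴱ y) *ᴱ gen b e ≋ 0ᴱ →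
                    Σ Elem λ z → Σ Elem λ w → pw a *ᴱ y ≋ z *ᴱ (pw a *ᴱ P e) +ᴱ pw (m ∸ b) *ᴱ w
  annihilator-gen a b {c = c} y refl c≤i a+b≤m ann = z , w , (begin
    pw a *ᴱ y
      ≈⟨ R.*-congˡ {pw a} (≗⇒≋ y≗Pz+w) ⟩
    pw a *ᴱ (P (fin c) *ᴱ z +ᴱ pᶻ K ·ᴱ w)
      ≈⟨ R.distribˡ (pw a) (P (fin c) *ᴱ z) (pᶻ K ·ᴱ w) ⟩
    pw a *ᴱ (P (fin c) *ᴱ z) +ᴱ pw a *ᴱ (pᶻ K ·ᴱ w)
      ≈⟨ R.+-congʳ {pw a *ᴱ (pᶻ K ·ᴱ w)} (R.sym (R.*-assoc (pw a) (P (fin c)) z)) ⟩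
    (pw a *ᴱ P (fin c)) *ᴱ z +ᴱ pw a *ᴱ (pᶻ K ·ᴱ w)
      ≈⟨ R.+-cong (R.*-comm (pw a *ᴱ P (fin c)) z) (≗⇒≋ remainder) ⟩
    z *ᴱ (pw a *ᴱ P (fin c)) +ᴱ pw (m ∸ b) *ᴱ w ∎)
    where
    open ≈-Reasoning
    K = m ∸ (a ℕ.+ b)
    X = σ^ (p ^ c) -ᴱ 1ᴱ
    p^[a+b]·yX≋0 : pᶻ (a ℕ.+ b) ·ᴱ (y *ᴱ X) ≋ 0ᴱ
    p^[a+b]·yX≋0 = begin
      pᶻ (a ℕ.+ b) ·ᴱ (y *ᴱ X)     ≈⟨ pw-*ᴱ-pw-*ᴱ a b y X ⟨
      (pw a *ᴱ y) *ᴱ (pw b *ᴱ X)   ≈⟨ ann ⟩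
      0ᴱ                           ∎
    kernel = σ^-1-kernel (pᶻ K) y c≤i (·ᴱ-≋0⇒∣ (a ℕ.+ b) (y *ᴱ X) p^[a+b]·yX≋0 a+b≤m)
    z = proj₁ kernel
    w = proj₁ (proj₂ kernel)
    y≗Pz+w = proj₂ (proj₂ kernel)
    a+K≡m∸b : a ℕ.+ K ≡ m ∸ b
    a+K≡m∸b = trans (cong (a ℕ.+_) (trans (cong (m ∸_) (ℕₚ.+-comm a b)) (sym (ℕₚ.∸-+-assoc m b a))))
                    (ℕₚ.m+[n∸m]≡n (ℕₚ.m+n≤o⇒m≤o∸n a a+b≤m))
    remainder : pw a *ᴱ (pᶻ K ·ᴱ w) ≗ pw (m ∸ b) *ᴱ w
    remainder k = trans (pw-*ᴱ-pᶻ·ᴱ a K w k) (cong (λ e → (pw e *ᴱ w) k) a+K≡m∸b)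

  P-annihilates-gen : ∀ {c c′} → c ≤ i → c ≤ c′ → ∀ u b → (u *ᴱ P (fin c)) *ᴱ gen b (fin c′) ≋ 0ᴱ
  P-annihilates-gen {c} {c′} c≤i c≤c′ u b = begin
    (u *ᴱ P (fin c)) *ᴱ (pw b *ᴱ X)    ≈⟨ interchange u (P (fin c)) (pw b) X ⟩
    (u *ᴱ pw b) *ᴱ (P (fin c) *ᴱ X)    ≈⟨ R.*-congˡ {u *ᴱ pw b} (P-*ᴱ-σ^-1 c≤i c≤c′) ⟩
    (u *ᴱ pw b) *ᴱ 0ᴱ                  ≈⟨ R.zeroʳ (u *ᴱ pw b) ⟩
    0ᴱ                                 ∎
    where
    open ≈-Reasoning
    X = σ^ (p ^ c′) -ᴱ 1ᴱ

  finite-above : ∀ {e e′} → e <ᵉ e′ → Σ ℕ λ c → e′ ≡ fin c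
  finite-above -∞<fin      = _ , refl
  finite-above (fin<fin _) = _ , refl

  fin-<ᵉ : ∀ {c₀ e} → fin c₀ <ᵉ e → Σ ℕ λ c → e ≡ fin c × c₀ < c
  fin-<ᵉ (fin<fin c₀<c) = _ , refl , c₀<c

  record Chain (t : ℕ) (b : Fin (suc t) → ℕ) (c : Fin (suc t) → Exp) : Set where
    field
      b<m          : ∀ j → b j < m
      c-valid      : ∀ j → ValidExp i (c j)
      b-decreasing : ∀ j k → j Fin.< k → b k < b j
      c-increasing : ∀ j k → j Fin.< k → c j <ᵉ c k

    b₀≤m : b Fin.zero ≤ m
    b₀≤m = ℕₚ.<⇒≤ (b<m Fin.zero)

    m≤[m∸b₀]+b₀ : m ≤ m ∸ b Fin.zero ℕ.+ b Fin.zero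
    m≤[m∸b₀]+b₀ = ℕₚ.≤-reflexive (sym (ℕₚ.m∸n+n≡m b₀≤m))

    b-later< : ∀ j → b (Fin.suc j) < b Fin.zero
    b-later< j = b-decreasing Fin.zero (Fin.suc j) (s≤s z≤n)

    c-later-finite : ∀ j → Σ ℕ λ cⱼ → c (Fin.suc j) ≡ fin cⱼ
    c-later-finite j = finite-above (c-increasing Fin.zero (Fin.suc j) (s≤s z≤n))

    finite-≤i : ∀ {j cⱼ} → c j ≡ fin cⱼ → cⱼ ≤ i
    finite-≤i {j} cⱼ≡ = ℕₚ.<⇒≤ (subst (ValidExp i) cⱼ≡ (c-valid j))

  tail-chain : ∀ {t b c} → Chain (suc t) b c → Chain t (b ∘ Fin.suc) (c ∘ Fin.suc)
  tail-chain ch = record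
    { b<m          = b<m ∘ Fin.suc
    ; c-valid      = c-valid ∘ Fin.suc
    ; b-decreasing = λ j k j<k → b-decreasing (Fin.suc j) (Fin.suc k) (s≤s j<k)
    ; c-increasing = λ j k j<k → c-increasing (Fin.suc j) (Fin.suc k) (s≤s j<k)
    }
    where open Chain ch

  tailGens : ∀ t → (Fin (suc t) → ℕ) → (Fin (suc t) → Exp) → List Elem
  tailGens t b c = tabulate (λ j → gen (b (Fin.suc j)) (c (Fin.suc j)))

  answer : ∀ t → (Fin (suc t) → ℕ) → (Fin (suc t) → Exp) → List Elem
  answer t b c = tabulate (λ j → pw (m ∸ b (inject₁ j)) *ᴱ P (c (Fin.suc j))) ++ (pw (m ∸ b (fromℕ t)) ∷ [])

  P-annihilates-gens : ∀ {t b c} → Chain t b c → ∀ {c₀} → c Fin.zero ≡ fin c₀ → ∀ u →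
                       Annihilates (u *ᴱ P (c Fin.zero)) (gen (b Fin.zero) (c Fin.zero) ∷ tailGens t b c)
  P-annihilates-gens {t} {b} {c} ch {c₀} c₀≡ u =
    subst (λ e → (u *ᴱ P e) *ᴱ gen (b Fin.zero) e ≋ 0ᴱ) (sym c₀≡)
          (P-annihilates-gen (finite-≤i c₀≡) ℕₚ.≤-refl u (b Fin.zero))
    ∷ Allₚ.tabulate⁺ later
    where
    open Chain ch
    later : ∀ j → (u *ᴱ P (c Fin.zero)) *ᴱ gen (b (Fin.suc j)) (c (Fin.suc j)) ≋ 0ᴱ
    later j with fin-<ᵉ (subst (_<ᵉ c (Fin.suc j)) c₀≡ (c-increasing Fin.zero (Fin.suc j) (s≤s z≤n)))
    ... | cⱼ , cⱼ≡ , c₀<cⱼ =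
      subst₂ (λ e₀ e → (u *ᴱ P e₀) *ᴱ gen (b (Fin.suc j)) e ≋ 0ᴱ) (sym c₀≡) (sym cⱼ≡)
             (P-annihilates-gen (finite-≤i c₀≡) (ℕₚ.<⇒≤ c₀<cⱼ) u (b (Fin.suc j)))

  answer-annihilates : ∀ {t b c} → Chain t b c → ∀ {g} u → g ≋ pw (b Fin.zero) *ᴱ u →
                       All (λ h → Annihilates h (g ∷ tailGens t b c)) (answer t b c)
  answer-annihilates {zero} {b} ch u g≋ =
    (pw-multiples-annihilate (m ∸ b Fin.zero) (b Fin.zero) 1ᴱ u m≤[m∸b₀]+b₀ (pw≋pw*1 (m ∸ b Fin.zero)) g≋ ∷ [])
    ∷ []
    where open Chain ch
  answer-annihilates {suc t} {b} {c} ch {g} u g≋ =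
    (pw-multiples-annihilate (m ∸ b₀) b₀ (P (c (Fin.suc Fin.zero))) u m≤[m∸b₀]+b₀ R.refl g≋
     ∷ P-annihilates-gens ch′ (proj₂ (c-later-finite Fin.zero)) (pw (m ∸ b₀)))
    ∷ All.zipWith (λ (h-ann-g , h-ann-gens) → All.head h-ann-g ∷ h-ann-gens)
                  ( answer-annihilates ch′ (pw (b₀ ∸ b₁) *ᴱ u) (R.trans g≋ (pw-split u b₁≤b₀))
                  , answer-annihilates ch′ (σ^p^ (c (Fin.suc Fin.zero)) -ᴱ 1ᴱ) R.refl)
    where
    open Chain ch
    ch′ = tail-chain ch
    b₀ = b Fin.zero
    b₁ = b (Fin.suc Fin.zero)
    b₁≤b₀ = ℕₚ.<⇒≤ (b-later< Fin.zero)

  annihilator⊆answer : ∀ {t b c} → Chain t b c → ∀ {x} → x *ᴱ pw (b Fin.zero) ≋ 0ᴱ →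
                       Annihilates x (tailGens t b c) → x ∈Ideal answer t b c
  annihilator⊆answer {zero} {b} ch {x} x*p^b₀≋0 _ = ∈∷ y 0ᴱ x≋y*p^[m∸b₀]+0 (∈[] R.refl)
    where
    open ≈-Reasoning
    x=p^[m∸b₀]*y = annihilator-pw x (b Fin.zero) (Chain.b₀≤m ch) x*p^b₀≋0
    y = proj₁ x=p^[m∸b₀]*y
    x≋y*p^[m∸b₀]+0 : x ≋ y *ᴱ pw (m ∸ b Fin.zero) +ᴱ 0ᴱ
    x≋y*p^[m∸b₀]+0 = begin
      x                                ≈⟨ proj₂ x=p^[m∸b₀]*y ⟩
      pw (m ∸ b Fin.zero) *ᴱ y         ≈⟨ R.*-comm (pw (m ∸ b Fin.zero)) y ⟩
      y *ᴱ pw (m ∸ b Fin.zero)         ≈⟨ R.+-identityʳ (y *ᴱ pw (m ∸ b Fin.zero)) ⟨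
      y *ᴱ pw (m ∸ b Fin.zero) +ᴱ 0ᴱ   ∎
  annihilator⊆answer {suc t} {b} {c} ch {x} x*p^b₀≋0 (x*g₁≋0 ∷ x-ann) =
    ∈∷ z x′ x≋zh₁+x′ (annihilator⊆answer ch′ (pw-complement-annihilates b₁ w b₁≤m) x′-ann)
    where
    open Chain ch
    ch′ = tail-chain ch
    b₀ = b Fin.zero
    b₁ = b (Fin.suc Fin.zero)
    b₁≤m = ℕₚ.<⇒≤ (b<m (Fin.suc Fin.zero))
    a = m ∸ b₀
    a+b₁≤m : a ℕ.+ b₁ ≤ m
    a+b₁≤m = ℕₚ.≤-trans (ℕₚ.+-monoʳ-≤ a (ℕₚ.<⇒≤ (b-later< Fin.zero))) (ℕₚ.≤-reflexive (ℕₚ.m∸n+n≡m b₀≤m))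
    x=p^a*y = annihilator-pw x b₀ b₀≤m x*p^b₀≋0
    y = proj₁ x=p^a*y
    c₁≡ = proj₂ (c-later-finite Fin.zero)
    h₁ = pw a *ᴱ P (c (Fin.suc Fin.zero))
    g₁ = gen b₁ (c (Fin.suc Fin.zero))
    p^a*y*g₁≋0 : (pw a *ᴱ y) *ᴱ g₁ ≋ 0ᴱ
    p^a*y*g₁≋0 = R.trans (R.*-congʳ {g₁} (R.sym (proj₂ x=p^a*y))) x*g₁≋0
    split = annihilator-gen a b₁ y c₁≡ (finite-≤i c₁≡) a+b₁≤m p^a*y*g₁≋0
    z = proj₁ split
    w = proj₁ (proj₂ split)
    x′ = pw (m ∸ b₁) *ᴱ w
    x≋zh₁+x′ : x ≋ z *ᴱ h₁ +ᴱ x′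
    x≋zh₁+x′ = R.trans {x} {pw a *ᴱ y} (proj₂ x=p^a*y) (proj₂ (proj₂ split))
    x′-ann : Annihilates x′ (tailGens t (b ∘ Fin.suc) (c ∘ Fin.suc))
    x′-ann = annihilates-remainder {x} {h₁} {x′} z x≋zh₁+x′ x-ann (All.tail (P-annihilates-gens ch′ c₁≡ (pw a)))

  annihilator-−∞ : ∀ {t b c} → Chain t b c → AnnEq (pw (b Fin.zero) ∷ tailGens t b c) (answer t b c)
  annihilator-−∞ {t} {b} {c} ch = AnnEq-intro _ _
    (λ x x-ann → annihilator⊆answer ch (All.head x-ann) (All.tail x-ann))
    (answer-annihilates ch 1ᴱ (pw≋pw*1 (b Fin.zero)))

  annihilator-fin : ∀ {t b c c₀} → Chain t b c → c Fin.zero ≡ fin c₀ →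
    AnnEq (gen (b Fin.zero) (c Fin.zero) ∷ tailGens t b c) (P (c Fin.zero) ∷ answer t b c)
  annihilator-fin {t} {b} {c} {c₀} ch c₀≡ = AnnEq-intro _ _ ann⊆
    (annihilates-resp-≈ (R.*-identityˡ P₀) (P-annihilates-gens ch c₀≡ 1ᴱ)
     ∷ answer-annihilates ch (σ^p^ (c Fin.zero) -ᴱ 1ᴱ) R.refl)
    where
    open Chain ch
    b₀ = b Fin.zero
    g₀ = gen b₀ (c Fin.zero)
    P₀ = P (c Fin.zero)
    ann⊆ : ∀ x → Annihilates x (g₀ ∷ tailGens t b c) → x ∈Ideal P₀ ∷ answer t b c
    ann⊆ x (x*g₀≋0 ∷ x-ann) =
      ∈∷ z x′ x≋zP₀+x′ (annihilator⊆answer ch (pw-complement-annihilates b₀ w b₀≤m) x′-ann)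
      where
      open ≈-Reasoning
      split = annihilator-gen 0 b₀ x c₀≡ (finite-≤i c₀≡) b₀≤m (R.trans (R.*-congʳ {g₀} (pw-0-*ᴱ x)) x*g₀≋0)
      z = proj₁ split
      w = proj₁ (proj₂ split)
      x′ = pw (m ∸ b₀) *ᴱ w
      x≋zP₀+x′ : x ≋ z *ᴱ P₀ +ᴱ x′
      x≋zP₀+x′ = begin
        x                              ≈⟨ pw-0-*ᴱ x ⟨
        pw 0 *ᴱ x                      ≈⟨ proj₂ (proj₂ split) ⟩
        z *ᴱ (pw 0 *ᴱ P₀) +ᴱ x′        ≈⟨ R.+-congʳ {x′} (R.*-congˡ {z} (pw-0-*ᴱ P₀)) ⟩
        z *ᴱ P₀ +ᴱ x′                  ∎
      x′-ann : Annihilates x′ (tailGens t b c)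
      x′-ann = annihilates-remainder {x} {P₀} {x′} z x≋zP₀+x′ x-ann
                 (annihilates-resp-≈ (R.*-identityˡ P₀) (All.tail (P-annihilates-gens ch c₀≡ 1ᴱ)))

≢-∞⇒fin : ∀ {e} → e ≢ -∞ → Σ ℕ λ c → e ≡ fin c
≢-∞⇒fin { -∞}    e≢-∞ = ⊥-elim (e≢-∞ refl)
≢-∞⇒fin {fin c} _    = c , refl

lemma2p8 : (p : ℕ) (pr : Prime p) (n m i : ℕ) → i ≤ n →
  (t : ℕ) (b : Fin (suc t) → ℕ) (c : Fin (suc t) → Exp) →
  (∀ j → b j < m) → (∀ j → ValidExp i (c j)) →
  (∀ j k → j Fin.< k → b k < b j) →
  (∀ j k → j Fin.< k → c j <ᵉ c k) →
  let open GroupRing p (prime⇒nonZero pr) i m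
      tailGens = tabulate {n = t} (λ j → pw (b (Fin.suc j)) *ᴱ (σ^p^ (c (Fin.suc j)) -ᴱ 1ᴱ))
      answer = tabulate {n = t} (λ j → pw (m ∸ b (inject₁ j)) *ᴱ P (c (Fin.suc j)))
               ++ (pw (m ∸ b (fromℕ t)) ∷ [])
  in (c Fin.zero ≡ -∞ → AnnEq (pw (b Fin.zero) ∷ tailGens) answer)
     × (c Fin.zero ≢ -∞ →
          AnnEq (pw (b Fin.zero) *ᴱ (σ^p^ (c Fin.zero) -ᴱ 1ᴱ) ∷ tailGens)
                (P (c Fin.zero) ∷ answer))
lemma2p8 p pr n m i _ t b c b<m c-valid b-decreasing c-increasing =
  (λ _ → annihilator-−∞ chain) , (λ c₀≢-∞ → annihilator-fin chain (proj₂ (≢-∞⇒fin c₀≢-∞)))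
  where
  open GroupRingProperties p (prime⇒nonZero pr) i m
  chain : Chain t b c
  chain = record { b<m = b<m ; c-valid = c-valid ; b-decreasing = b-decreasing ; c-increasing = c-increasing }
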